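{- Let $\sigma_{\widehat{\mathrm{mex}}}(n)$ denote the sum of $\widehat{\mathrm{mex}}(\pi)$ over all overpartitions $\pi$ of $n$ (for $n\ge 1$), with $\sigma_{\widehat{\mathrm{mex}}}(0)=1$. Then, as formal power series in $q$, \[\sum_{n=0}^\infty \sigma_{\widehat{\mathrm{mex}}}(n)\, q^n=\frac{(-q;q)_\infty}{(q;q)_\infty}\sum_{m=0}^\infty \frac{m\,q^{\binom{m}{2}}}{(-q;q)_m}=\overline{P}(q)\,\sigma(q),\] where $\overline{P}(q)=\sum_{n\ge 0}\overline{p}(n)q^n=\frac{(-q;q)_\infty}{(q;q)_\infty}$ is the generating function of the overpartition numbers and $\sigma(q)=\sum_{m=0}^\infty \frac{q^{\binom{m+1}{2}}}{(-q;q)_m}$ is Ramanujan's $q$-series.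
   Context: An overpartition of a positive integer $n$ is a non-increasing sequence of positive integers summing to $n$ in which the first occurrence of each number may (or may not) be overlined; $\overline{p}(n)$ is the number of overpartitions of $n$ ($\overline{p}(0)=1$). For an overpartition $\pi$, $\widehat{\mathrm{mex}}(\pi)$ (the minimal excludant of the overlined parts) is the smallest positive integer that does not occur as an overlined part of $\pi$. Notation: $(a;q)_m=\prod_{k=0}^{m-1}(1-aq^k)$ and $(a;q)_\infty=\prod_{k=0}^{\infty}(1-aq^k)$. -}

module Defs where

open import Data.Nat as ℕ using (ℕ; zero; suc; _≤ᵇ_; _≡ᵇ_)
open import Data.Nat.Combinatorics using (_C_)
open import Data.Integer as ℤ using (ℤ; +_; -_; _+_; _*_)
open import Data.Bool using (Bool; true; false; _∧_; not; if_then_else_)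
open import Data.Product using (_×_; _,_; proj₁; proj₂)
open import Data.List using (List; []; _∷_; map; concatMap; upTo; filter; length; foldr)
open import Function using (_∘_)
open import Relation.Nullary.Decidable using (Dec; yes; no)
open import Relation.Binary.PropositionalEquality using (_≡_)

-- A candidate overpartition is a list of parts (written in order),
-- each part tagged with a flag saying whether it is overlined.
Part : Set
Part = ℕ × Bool

partSum : List Part → ℕ
partSum []            = 0
partSum ((a , _) ∷ xs) = a ℕ.+ partSum xs

allPositive : List Part → Bool
allPositive []             = true
allPositive ((a , _) ∷ xs) = (1 ≤ᵇ a) ∧ allPositive xs

-- non-increasing, and only the first occurrence of a value may be overlined:
-- for consecutive parts (a , f) (b , g) we need b ≤ a, and if b = a then g = false.
wellOrdered : List Part → Bool
wellOrdered []                           = true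
wellOrdered (_ ∷ [])                     = true
wellOrdered ((a , f) ∷ (b , g) ∷ xs) =
  (b ≤ᵇ a) ∧ (if b ≡ᵇ a then not g else true) ∧ wellOrdered ((b , g) ∷ xs)

isOverpartition : ℕ → List Part → Bool
isOverpartition n xs = (partSum xs ≡ᵇ n) ∧ allPositive xs ∧ wellOrdered xs

words : {A : Set} → List A → ℕ → List (List A)
words as zero    = [] ∷ []
words as (suc L) = concatMap (λ a → map (a ∷_) (words as L)) as

alphabet : ℕ → List Part
alphabet n = concatMap (λ k → (suc k , false) ∷ (suc k , true) ∷ []) (upTo n)

-- every overpartition of n has at most n parts, each in 1..n; each word is
-- listed exactly once (words of different lengths are distinct)
candidates : ℕ → List (List Part)
candidates n = concatMap (words (alphabet n)) (upTo (suc n))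

overpartitions : ℕ → List (List Part)
overpartitions n = filter (λ xs → isOverpartitionDec xs) (candidates n)
  where
  isOverpartitionDec : (xs : List Part) → Dec (isOverpartition n xs ≡ true)
  isOverpartitionDec xs with isOverpartition n xs
  ... | true  = yes _≡_.refl
  ... | false = no (λ ())

pbar : ℕ → ℕ
pbar n = length (overpartitions n)

occursOverlined : ℕ → List Part → Bool
occursOverlined k []              = false
occursOverlined k ((a , f) ∷ xs) = (f ∧ (a ≡ᵇ k)) Data.Bool.∨ occursOverlined k xs

mexSearch : ℕ → ℕ → List Part → ℕ
mexSearch zero       k xs = k
mexSearch (suc fuel) k xs =
  if occursOverlined k xs then mexSearch fuel (suc k) xs else k

-- mex-hat: smallest positive integer not occurring as an overlined part.
-- (fuel length xs + 1 suffices: at most length xs values occur.)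
mexHat : List Part → ℕ
mexHat xs = mexSearch (suc (length xs)) 1 xs

sumℕ : List ℕ → ℕ
sumℕ = foldr ℕ._+_ 0

sigmaMex : ℕ → ℕ
sigmaMex zero    = 1
sigmaMex (suc n) = sumℕ (map mexHat (overpartitions (suc n)))

FPS : Set
FPS = ℕ → ℤ

sumTo : ℕ → (ℕ → ℤ) → ℤ
sumTo zero    h = h 0
sumTo (suc n) h = sumTo n h + h (suc n)

sumFrom1 : ℕ → (ℕ → ℤ) → ℤ
sumFrom1 zero    h = + 0
sumFrom1 (suc n) h = sumFrom1 n h + h (suc n)

oneS : FPS
oneS zero    = + 1
oneS (suc _) = + 0

mono : ℕ → FPS
mono k n = if n ≡ᵇ k then + 1 else + 0

_⊕_ : FPS → FPS → FPS
(f ⊕ g) n = f n + g n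

negS : FPS → FPS
negS f n = - f n

_⊖_ : FPS → FPS → FPS
f ⊖ g = f ⊕ negS g

_⊛_ : FPS → FPS → FPS
(f ⊛ g) n = sumTo n (λ k → f k * g (n ℕ.∸ k))

infixl 7 _⊛_
infixl 6 _⊕_ _⊖_

_·_ : ℤ → FPS → FPS
(c · f) n = c * f n

-- Multiplicative inverse of a series with constant term 1:
-- b₀ = 1, b_N = - Σ_{k=1}^{N} f_k b_{N-k}.
-- invApprox f N is correct on all indices ≤ N.
invApprox : FPS → ℕ → FPS
invApprox f zero    m = oneS m
invApprox f (suc N) m with m ≡ᵇ suc N
... | true  = - sumFrom1 (suc N) (λ k → f k * invApprox f N (suc N ℕ.∸ k))
... | false = invApprox f N m

inv : FPS → FPS
inv f n = invApprox f n n

-- f / g  (g must have constant term 1)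
_⊘_ : FPS → FPS → FPS
f ⊘ g = f ⊛ inv g

poch : FPS → ℕ → FPS
poch a zero    = oneS
poch a (suc m) = poch a m ⊛ (oneS ⊖ a ⊛ mono m)

-- (a;q)_∞ for a with zero constant term: its q^n coefficient agrees with
-- that of (a;q)_{n+1} (later factors are ≡ 1 mod q^{n+1}).
pochInf : FPS → FPS
pochInf a n = poch a (suc n) n

-- Σ_{m ≥ 0} T m, for families with ord(T m) ≥ m - 1 (so only m ≤ n+1
-- contribute to the q^n coefficient).
infSum : (ℕ → FPS) → FPS
infSum T n = sumTo (suc n) (λ m → T m n)

minusQ : FPS
minusQ = negS (mono 1)

q : FPS
q = mono 1

SigmaMexGF : FPS
SigmaMexGF n = + sigmaMex n

PbarGF : FPS
PbarGF n = + pbar n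

PbarProd : FPS
PbarProd = pochInf minusQ ⊘ pochInf q

S1 : FPS
S1 = infSum (λ m → ((+ m) · mono (m C 2)) ⊘ poch minusQ m)

sigmaR : FPS
sigmaR = infSum (λ m → mono (suc m C 2) ⊘ poch minusQ m)

_≋_ : FPS → FPS → Set
f ≋ g = ∀ n → f n ≡ g n

-- Since mex̂(π) = Σ_{j ≥ 0} [1, …, j all occur overlined in π], σ_mex(n) counts pairs (π, j) with
-- π an overpartition of n containing 1̄, …, j̄. Splitting off the largest part shows that the generating
-- function of such overpartitions with parts ≤ b is q^C(j+1,2) (-q;q)_b / ((q;q)_b (-q;q)_j); these
-- stabilise as b grows, and summing over j gives P̄(q) σ(q). The middle series equals P̄(q) σ(q) by
-- Abel summation: with σ_m = q^C(m+1,2)/(-q;q)_m one has q^C(m+1,2)/(-q;q)_(m+1) = σ_m − σ_(m+1), so the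
-- m-weighted sum telescopes to Σ σ_m.

module Submission where

open import Defs
open import Data.Bool using (Bool; true; false; if_then_else_; _∧_; _∨_; not; T)
import Data.Bool.Properties as Bool
open import Data.Maybe using (Maybe; just; nothing; maybe′)
open import Data.Nat as ℕ using (ℕ; zero; suc; _∸_; _≤_; _<_; z≤n; s≤s; _≤ᵇ_; _≡ᵇ_; _<ᵇ_; pred)
import Data.Nat.Properties as ℕ
open import Data.Nat.Combinatorics using (_C_; nCk+nC[k+1]≡[n+1]C[k+1]; nC1≡n)
open import Data.List using (List; []; _∷_; map; concatMap; upTo; applyUpTo; filter; length; _++_)
open import Data.Product using (_×_; _,_; proj₁; proj₂)
open import Data.Sum using (inj₁; inj₂)
open import Data.Empty using (⊥-elim)
open import Function using (_∘_; id; Equivalence)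
open import Relation.Binary.PropositionalEquality
open import Relation.Binary.Definitions using (tri<; tri≈; tri>)
open import Relation.Nullary using (¬_; Dec; yes; no)
open import Relation.Nullary.Decidable using (dec-true; dec-false; dec⇒maybe)
import Algebra.Properties.CommutativeSemigroup as CommutativeSemigroupProperties

≡ᵇ-refl : ∀ n → (n ≡ᵇ n) ≡ true
≡ᵇ-refl n = dec-true (n ℕ.≟ n) refl

≢⇒≡ᵇ-false : ∀ {m n} → m ≢ n → (m ≡ᵇ n) ≡ false
≢⇒≡ᵇ-false {m} {n} = dec-false (m ℕ.≟ n)

≡ᵇ-true⇒≡ : ∀ {m n} → (m ≡ᵇ n) ≡ true → m ≡ n
≡ᵇ-true⇒≡ {m} {n} e = ℕ.≡ᵇ⇒≡ m n (Equivalence.from Bool.T-≡ e)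

≤⇒≤ᵇ-true : ∀ {m n} → m ≤ n → (m ≤ᵇ n) ≡ true
≤⇒≤ᵇ-true {m} {n} = dec-true (m ℕ.≤? n)

>⇒≤ᵇ-false : ∀ {m n} → n < m → (m ≤ᵇ n) ≡ false
>⇒≤ᵇ-false {m} {n} n<m = dec-false (m ℕ.≤? n) (ℕ.<⇒≱ n<m)

<⇒<ᵇ-true : ∀ {m n} → m < n → (m <ᵇ n) ≡ true
<⇒<ᵇ-true {m} {n} = dec-true (m ℕ.<? n)

≮⇒<ᵇ-false : ∀ {m n} → ¬ m < n → (m <ᵇ n) ≡ false
≮⇒<ᵇ-false {m} {n} = dec-false (m ℕ.<? n)

stable⇒≡diagonal : ∀ {A : Set} (P : ℕ → ℕ → A) → (∀ M k → k ≤ M → P (suc M) k ≡ P M k) →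
  ∀ {k N} → k ≤ N → P N k ≡ P k k
stable⇒≡diagonal P stable {N = zero}  z≤n   = refl
stable⇒≡diagonal P stable {N = suc N} k≤1+N with ℕ.m≤n⇒m<n∨m≡n k≤1+N
... | inj₁ k<1+N = trans (stable N _ (ℕ.≤-pred k<1+N)) (stable⇒≡diagonal P stable (ℕ.≤-pred k<1+N))
... | inj₂ refl  = refl

module PowerSeries where

  open import Algebra.Bundles using (CommutativeRing)
  import Algebra.Solver.Ring
  open import Algebra.Solver.Ring.AlmostCommutativeRing using (fromCommutativeRing; _-Raw-AlmostCommutative⟶_)
  open import Data.Integer as ℤ using (ℤ; +_; -_; _+_; _*_; _-_)
  import Data.Integer.Properties as ℤ
  open import Data.Integer.Tactic.RingSolver using (solve-∀)
  import Data.Maybe as Maybe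
  open import Level using (0ℓ)
  import Relation.Binary.Reasoning.Setoid as SetoidReasoning

  sumTo-cong≤ : ∀ n {h h′ : ℕ → ℤ} → (∀ k → k ≤ n → h k ≡ h′ k) → sumTo n h ≡ sumTo n h′
  sumTo-cong≤ zero    e = e 0 z≤n
  sumTo-cong≤ (suc n) e = cong₂ _+_ (sumTo-cong≤ n (λ k k≤n → e k (ℕ.m≤n⇒m≤1+n k≤n))) (e (suc n) ℕ.≤-refl)

  sumTo-cong : ∀ n {h h′ : ℕ → ℤ} → (∀ k → h k ≡ h′ k) → sumTo n h ≡ sumTo n h′
  sumTo-cong n e = sumTo-cong≤ n (λ k _ → e k)

  sumTo-+ : ∀ n (h h′ : ℕ → ℤ) → sumTo n (λ k → h k + h′ k) ≡ sumTo n h + sumTo n h′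
  sumTo-+ zero    h h′ = refl
  sumTo-+ (suc n) h h′ = trans (cong (_+ (h (suc n) + h′ (suc n))) (sumTo-+ n h h′))
    (+-interchange (sumTo n h) (sumTo n h′) (h (suc n)) (h′ (suc n)))
    where open CommutativeSemigroupProperties ℤ.+-commutativeSemigroup using () renaming (interchange to +-interchange)

  sumTo-*ˡ : ∀ n c (h : ℕ → ℤ) → c * sumTo n h ≡ sumTo n (λ k → c * h k)
  sumTo-*ˡ zero    c h = refl
  sumTo-*ˡ (suc n) c h = trans (ℤ.*-distribˡ-+ c (sumTo n h) (h (suc n))) (cong (_+ c * h (suc n)) (sumTo-*ˡ n c h))

  sumTo-*ʳ : ∀ n c (h : ℕ → ℤ) → sumTo n h * c ≡ sumTo n (λ k → h k * c)
  sumTo-*ʳ n c h = trans (ℤ.*-comm (sumTo n h) c) (trans (sumTo-*ˡ n c h) (sumTo-cong n (λ k → ℤ.*-comm c (h k))))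

  sumTo-suc : ∀ n (h : ℕ → ℤ) → sumTo (suc n) h ≡ h 0 + sumTo n (h ∘ suc)
  sumTo-suc zero    h = refl
  sumTo-suc (suc n) h = trans (cong (_+ h (suc (suc n))) (sumTo-suc n h)) (ℤ.+-assoc (h 0) (sumTo n (h ∘ suc)) _)

  sumTo-reverse : ∀ n (h : ℕ → ℤ) → sumTo n h ≡ sumTo n (λ k → h (n ∸ k))
  sumTo-reverse zero    h = refl
  sumTo-reverse (suc n) h = begin
    sumTo n h + h (suc n)                  ≡⟨ cong (_+ h (suc n)) (sumTo-reverse n h) ⟩
    sumTo n (λ k → h (n ∸ k)) + h (suc n)  ≡⟨ ℤ.+-comm _ (h (suc n)) ⟩
    h (suc n) + sumTo n (λ k → h (n ∸ k))  ≡⟨ sumTo-suc n (λ k → h (suc n ∸ k)) ⟨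
    sumTo (suc n) (λ k → h (suc n ∸ k))    ∎
    where open ≡-Reasoning

  sumTo-triangle : ∀ n (F : ℕ → ℕ → ℤ) →
    sumTo n (λ k → sumTo k (λ i → F i k)) ≡ sumTo n (λ i → sumTo (n ∸ i) (λ t → F i (i ℕ.+ t)))
  sumTo-triangle zero    F = refl
  sumTo-triangle (suc n) F = begin
    sumTo n (λ k → sumTo k (λ i → F i k)) + (sumTo n (λ i → F i (suc n)) + F (suc n) (suc n))
      ≡⟨ cong (_+ (sumTo n (λ i → F i (suc n)) + F (suc n) (suc n))) (sumTo-triangle n F) ⟩
    Row n + (sumTo n (λ i → F i (suc n)) + F (suc n) (suc n))
      ≡⟨ ℤ.+-assoc (Row n) _ _ ⟨
    Row n + sumTo n (λ i → F i (suc n)) + F (suc n) (suc n)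
      ≡⟨ cong (_+ F (suc n) (suc n)) (sumTo-+ n _ _) ⟨
    sumTo n (λ i → sumTo (n ∸ i) (λ t → F i (i ℕ.+ t)) + F i (suc n)) + F (suc n) (suc n)
      ≡⟨ cong₂ _+_ (sumTo-cong≤ n extendRow) lastRow ⟩
    sumTo (suc n) (λ i → sumTo (suc n ∸ i) (λ t → F i (i ℕ.+ t))) ∎
    where
    open ≡-Reasoning
    Row : ℕ → ℤ
    Row m = sumTo m (λ i → sumTo (m ∸ i) (λ t → F i (i ℕ.+ t)))
    lastRow : F (suc n) (suc n) ≡ sumTo (n ∸ n) (λ t → F (suc n) (suc n ℕ.+ t))
    lastRow rewrite ℕ.n∸n≡0 n | ℕ.+-identityʳ n = refl
    extendRow : ∀ i → i ≤ n →
      sumTo (n ∸ i) (λ t → F i (i ℕ.+ t)) + F i (suc n) ≡ sumTo (suc n ∸ i) (λ t → F i (i ℕ.+ t))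
    extendRow i i≤n rewrite ℕ.+-∸-assoc 1 i≤n =
      cong (λ m → sumTo (n ∸ i) (λ t → F i (i ℕ.+ t)) + F i m)
           (trans (cong suc (sym (ℕ.m+[n∸m]≡n i≤n))) (sym (ℕ.+-suc i (n ∸ i))))

  sumTo-vanishing : ∀ {m n} (h : ℕ → ℤ) → m ≤ n → (∀ j → m < j → h j ≡ + 0) → sumTo n h ≡ sumTo m h
  sumTo-vanishing {m} {n} h m≤n vanish with ℕ.m≤n⇒m<n∨m≡n m≤n
  ... | inj₂ refl = refl
  ... | inj₁ m<n with n
  ...   | suc n′ = trans (cong₂ _+_ (sumTo-vanishing h (ℕ.≤-pred m<n) vanish) (vanish (suc n′) m<n)) (ℤ.+-identityʳ _)

  -- The ring of formal power series

  zeroS : FPS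
  zeroS _ = + 0

  ⊛-cong : ∀ {f f′ g g′} → f ≋ f′ → g ≋ g′ → (f ⊛ g) ≋ (f′ ⊛ g′)
  ⊛-cong ef eg n = sumTo-cong n (λ k → cong₂ _*_ (ef k) (eg (n ∸ k)))

  ⊛-congˡ : ∀ f {g g′} → g ≋ g′ → (f ⊛ g) ≋ (f ⊛ g′)
  ⊛-congˡ f = ⊛-cong {f} {f} (λ _ → refl)

  ⊛-congʳ : ∀ g {f f′} → f ≋ f′ → (f ⊛ g) ≋ (f′ ⊛ g)
  ⊛-congʳ g f≋f′ = ⊛-cong {g = g} {g} f≋f′ (λ _ → refl)

  ⊛-comm : ∀ f g → (f ⊛ g) ≋ (g ⊛ f)
  ⊛-comm f g n = trans (sumTo-reverse n _) (sumTo-cong≤ n λ k k≤n →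
    trans (ℤ.*-comm (f (n ∸ k)) _) (cong (λ i → g i * f (n ∸ k)) (ℕ.m∸[m∸n]≡n k≤n)))

  ⊛-assoc : ∀ f g h → ((f ⊛ g) ⊛ h) ≋ (f ⊛ (g ⊛ h))
  ⊛-assoc f g h n = begin
    sumTo n (λ k → sumTo k (λ i → f i * g (k ∸ i)) * h (n ∸ k))
      ≡⟨ sumTo-cong n (λ k → sumTo-*ʳ k (h (n ∸ k)) _) ⟩
    sumTo n (λ k → sumTo k (λ i → f i * g (k ∸ i) * h (n ∸ k)))
      ≡⟨ sumTo-triangle n (λ i k → f i * g (k ∸ i) * h (n ∸ k)) ⟩
    sumTo n (λ i → sumTo (n ∸ i) (λ t → f i * g (i ℕ.+ t ∸ i) * h (n ∸ (i ℕ.+ t))))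
      ≡⟨ sumTo-cong n (λ i → sumTo-cong (n ∸ i) (λ t →
           trans (cong₂ (λ a b → f i * g a * h b) (ℕ.m+n∸m≡n i t) (sym (ℕ.∸-+-assoc n i t)))
                 (ℤ.*-assoc (f i) _ _))) ⟩
    sumTo n (λ i → sumTo (n ∸ i) (λ t → f i * (g t * h (n ∸ i ∸ t))))
      ≡⟨ sumTo-cong n (λ i → sumTo-*ˡ (n ∸ i) (f i) _) ⟨
    sumTo n (λ i → f i * sumTo (n ∸ i) (λ t → g t * h (n ∸ i ∸ t))) ∎
    where open ≡-Reasoning

  ⊛-distribˡ-⊕ : ∀ f g h → (f ⊛ (g ⊕ h)) ≋ (f ⊛ g ⊕ f ⊛ h)
  ⊛-distribˡ-⊕ f g h n = trans (sumTo-cong n (λ k → ℤ.*-distribˡ-+ (f k) _ _)) (sumTo-+ n _ _)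

  ⊛-distribʳ-⊕ : ∀ f g h → ((g ⊕ h) ⊛ f) ≋ (g ⊛ f ⊕ h ⊛ f)
  ⊛-distribʳ-⊕ f g h n = trans (sumTo-cong n (λ k → ℤ.*-distribʳ-+ (f (n ∸ k)) (g k) (h k))) (sumTo-+ n _ _)

  sumTo-mono : ∀ n m (g : ℕ → ℤ) → sumTo n (λ k → mono m k * g k) ≡ (if m ≤ᵇ n then g m else + 0)
  sumTo-mono zero    zero    g = ℤ.*-identityˡ (g 0)
  sumTo-mono zero    (suc m) g = refl
  sumTo-mono (suc n) m       g with ℕ.<-cmp m (suc n)
  ... | tri< m<1+n _ _
    rewrite sumTo-mono n m g | ≤⇒≤ᵇ-true (ℕ.≤-pred m<1+n) | ≤⇒≤ᵇ-true (ℕ.<⇒≤ m<1+n)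
          | ≢⇒≡ᵇ-false (ℕ.>⇒≢ m<1+n) = ℤ.+-identityʳ (g m)
  ... | tri≈ _ refl _
    rewrite sumTo-mono n (suc n) g | >⇒≤ᵇ-false (ℕ.n<1+n n) | ≤⇒≤ᵇ-true (ℕ.≤-refl {suc n}) | ≡ᵇ-refl n
    = trans (ℤ.+-identityˡ _) (ℤ.*-identityˡ (g (suc n)))
  ... | tri> _ _ 1+n<m
    rewrite sumTo-mono n m g | >⇒≤ᵇ-false (ℕ.<-trans (ℕ.n<1+n n) 1+n<m) | >⇒≤ᵇ-false 1+n<m
          | ≢⇒≡ᵇ-false (ℕ.<⇒≢ 1+n<m) = refl

  mono-⊛ : ∀ m g n → (mono m ⊛ g) n ≡ (if m ≤ᵇ n then g (n ∸ m) else + 0)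
  mono-⊛ m g n = sumTo-mono n m (λ k → g (n ∸ k))

  oneS≋mono0 : oneS ≋ mono 0
  oneS≋mono0 zero    = refl
  oneS≋mono0 (suc n) = refl

  ⊛-identityˡ : ∀ f → (oneS ⊛ f) ≋ f
  ⊛-identityˡ f n = trans (⊛-cong {g = f} oneS≋mono0 (λ _ → refl) n) (mono-⊛ 0 f n)

  ⊛-identityʳ : ∀ f → (f ⊛ oneS) ≋ f
  ⊛-identityʳ f n = trans (⊛-comm f oneS n) (⊛-identityˡ f n)

  fpsRing : CommutativeRing 0ℓ 0ℓ
  fpsRing = record
    { Carrier = FPS ; _≈_ = _≋_ ; _+_ = _⊕_ ; _*_ = _⊛_ ; -_ = negS ; 0# = zeroS ; 1# = oneS
    ; isCommutativeRing = record
      { isRing = record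
        { +-isAbelianGroup = record
          { isGroup = record
            { isMonoid = record
              { isSemigroup = record
                { isMagma = record
                  { isEquivalence = record
                    { refl = λ _ → refl ; sym = λ e n → sym (e n) ; trans = λ e e′ n → trans (e n) (e′ n) }
                  ; ∙-cong = λ e e′ n → cong₂ _+_ (e n) (e′ n) }
                ; assoc = λ f g h n → ℤ.+-assoc (f n) (g n) (h n) }
              ; identity = (λ f n → ℤ.+-identityˡ (f n)) , (λ f n → ℤ.+-identityʳ (f n)) }
            ; inverse = (λ f n → ℤ.+-inverseˡ (f n)) , (λ f n → ℤ.+-inverseʳ (f n))
            ; ⁻¹-cong = λ e n → cong -_ (e n) }
          ; comm = λ f g n → ℤ.+-comm (f n) (g n) }
        ; *-cong = ⊛-cong
        ; *-assoc = ⊛-assoc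
        ; *-identity = ⊛-identityˡ , ⊛-identityʳ
        ; distrib = ⊛-distribˡ-⊕ , ⊛-distribʳ-⊕ }
      ; *-comm = ⊛-comm } }

  open CommutativeRing fpsRing public
    using ()
    renaming ( setoid to ≋-setoid; refl to ≋-refl; sym to ≋-sym; trans to ≋-trans
             ; +-cong to ⊕-cong; -‿cong to negS-cong; +-identityˡ to ⊕-identityˡ; zeroʳ to ⊛-zeroʳ )

  module ≋-Reasoning = SetoidReasoning ≋-setoid

  ·-⊛ : ∀ c f g → ((c · f) ⊛ g) ≋ (c · (f ⊛ g))
  ·-⊛ c f g n = trans (sumTo-cong n (λ k → ℤ.*-assoc c (f k) (g (n ∸ k)))) (sym (sumTo-*ˡ n c _))

  constS : ℤ → FPS
  constS c = c · oneS

  constS-homomorphism : ℤ.+-*-rawRing -Raw-AlmostCommutative⟶ fromCommutativeRing fpsRing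
  constS-homomorphism = record
    { ⟦_⟧    = constS
    ; +-homo = λ a b n → ℤ.*-distribʳ-+ (oneS n) a b
    ; *-homo = λ a b n → trans (ℤ.*-assoc a b (oneS n))
                           (sym (trans (·-⊛ a oneS (constS b) n) (cong (a *_) (⊛-identityˡ (constS b) n))))
    ; -‿homo = λ a n → sym (ℤ.neg-distribˡ-* a (oneS n))
    ; 0-homo = λ n → ℤ.*-zeroˡ (oneS n)
    ; 1-homo = λ n → ℤ.*-identityˡ (oneS n)
    }

  -- Integer coefficients, embedded as constant series, let the normaliser cancel like terms.
  open Algebra.Solver.Ring ℤ.+-*-rawRing (fromCommutativeRing fpsRing) constS-homomorphism
    (λ a b → Maybe.map (λ a≡b n → cong (λ c → c * oneS n) a≡b) (dec⇒maybe (a ℤ.≟ b)))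
    public using (solve; _:+_; _:*_; :-_; _:-_; _:=_)

  sumSeries : ℕ → (ℕ → FPS) → FPS
  sumSeries M f n = sumTo M (λ j → f j n)

  ⊛-sumSeries : ∀ M f g → (f ⊛ sumSeries M g) ≋ sumSeries M (λ j → f ⊛ g j)
  ⊛-sumSeries zero    f g = ≋-refl
  ⊛-sumSeries (suc M) f g =
    ≋-trans (⊛-distribˡ-⊕ f (sumSeries M g) (g (suc M))) (⊕-cong (⊛-sumSeries M f g) (≋-refl {f ⊛ g (suc M)}))

  sumFrom1-cong≤ : ∀ n {h h′ : ℕ → ℤ} → (∀ k → k < n → h (suc k) ≡ h′ (suc k)) → sumFrom1 n h ≡ sumFrom1 n h′
  sumFrom1-cong≤ zero    e = refl
  sumFrom1-cong≤ (suc n) e = cong₂ _+_ (sumFrom1-cong≤ n (λ k k<n → e k (ℕ.m<n⇒m<1+n k<n))) (e n ℕ.≤-refl)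

  sumTo≡head+sumFrom1 : ∀ n (h : ℕ → ℤ) → sumTo n h ≡ h 0 + sumFrom1 n h
  sumTo≡head+sumFrom1 zero    h = sym (ℤ.+-identityʳ (h 0))
  sumTo≡head+sumFrom1 (suc n) h =
    trans (cong (_+ h (suc n)) (sumTo≡head+sumFrom1 n h)) (ℤ.+-assoc (h 0) (sumFrom1 n h) (h (suc n)))

  invApprox-stable : ∀ f {N m} → m ≤ N → invApprox f N m ≡ inv f m
  invApprox-stable f {zero}  {zero} _ = refl
  invApprox-stable f {suc N} {m}    m≤1+N with m ℕ.≟ suc N
  ... | yes refl = refl
  ... | no  m≢1+N rewrite ≢⇒≡ᵇ-false m≢1+N = invApprox-stable f (ℕ.≤-pred (ℕ.≤∧≢⇒< m≤1+N m≢1+N))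

  inv-suc : ∀ f N → inv f (suc N) ≡ - sumFrom1 (suc N) (λ k → f k * inv f (suc N ∸ k))
  inv-suc f N with invApprox f (suc N) (suc N) in eq
  ... | _ rewrite ≡ᵇ-refl N | sym eq =
    cong -_ (sumFrom1-cong≤ (suc N) (λ k _ → cong (f (suc k) *_) (invApprox-stable f (ℕ.m∸n≤m N k))))

  ⊛-inverseʳ : ∀ g → g 0 ≡ + 1 → (g ⊛ inv g) ≋ oneS
  ⊛-inverseʳ g g0≡1 zero    rewrite g0≡1 = refl
  ⊛-inverseʳ g g0≡1 (suc N) = begin
    sumTo (suc N) (λ k → g k * inv g (suc N ∸ k)) ≡⟨ sumTo≡head+sumFrom1 (suc N) _ ⟩
    g 0 * inv g (suc N) + S                       ≡⟨ cong₂ (λ a b → a * b + S) g0≡1 (inv-suc g N) ⟩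
    + 1 * - S + S                                 ≡⟨ cong (_+ S) (ℤ.*-identityˡ (- S)) ⟩
    - S + S                                       ≡⟨ ℤ.+-inverseˡ S ⟩
    + 0                                           ∎
    where
    open ≡-Reasoning
    S = sumFrom1 (suc N) (λ k → g k * inv g (suc N ∸ k))

  ⊛-inverseˡ : ∀ g → g 0 ≡ + 1 → (inv g ⊛ g) ≋ oneS
  ⊛-inverseˡ g g0≡1 = ≋-trans (⊛-comm (inv g) g) (⊛-inverseʳ g g0≡1)

  ⊘-unique : ∀ {f g h} → g 0 ≡ + 1 → (h ⊛ g) ≋ f → h ≋ (f ⊘ g)
  ⊘-unique {f} {g} {h} g0≡1 hg≋f = begin
    h                ≈⟨ ⊛-identityʳ h ⟨
    h ⊛ oneS         ≈⟨ ⊛-congˡ h (⊛-inverseʳ g g0≡1) ⟨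
    h ⊛ (g ⊛ inv g)  ≈⟨ ⊛-assoc h g (inv g) ⟨
    (h ⊛ g) ⊛ inv g  ≈⟨ ⊛-congʳ (inv g) hg≋f ⟩
    f ⊛ inv g        ∎
    where open ≋-Reasoning

  ⊘-⊛-cancel : ∀ f {g} → g 0 ≡ + 1 → ((f ⊘ g) ⊛ g) ≋ f
  ⊘-⊛-cancel f {g} g0≡1 = begin
    (f ⊛ inv g) ⊛ g  ≈⟨ ⊛-assoc f (inv g) g ⟩
    f ⊛ (inv g ⊛ g)  ≈⟨ ⊛-congˡ f (⊛-inverseˡ g g0≡1) ⟩
    f ⊛ oneS         ≈⟨ ⊛-identityʳ f ⟩
    f                ∎
    where open ≋-Reasoning

  ⊛-cancelʳ : ∀ {f f′ g} → g 0 ≡ + 1 → (f ⊛ g) ≋ (f′ ⊛ g) → f ≋ f′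
  ⊛-cancelʳ {_} {f′} {g} g0≡1 fg≋f′g =
    ≋-trans (⊘-unique {g = g} g0≡1 ≋-refl) (≋-sym (⊘-unique {g = g} {f′} g0≡1 (≋-sym fg≋f′g)))

  infix 4 _≋[_]_
  _≋[_]_ : FPS → ℕ → FPS → Set
  f ≋[ N ] g = ∀ n → n ≤ N → f n ≡ g n

  ≋⇒≋[] : ∀ {f g} N → f ≋ g → f ≋[ N ] g
  ≋⇒≋[] N f≋g n _ = f≋g n

  ≋[]-sym : ∀ {f g N} → f ≋[ N ] g → g ≋[ N ] f
  ≋[]-sym f≋g n n≤N = sym (f≋g n n≤N)

  ≋[]-trans : ∀ {f g h N} → f ≋[ N ] g → g ≋[ N ] h → f ≋[ N ] h
  ≋[]-trans f≋g g≋h n n≤N = trans (f≋g n n≤N) (g≋h n n≤N)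

  ⊛-cong-≋[] : ∀ {f f′ g g′ N} → f ≋[ N ] f′ → g ≋[ N ] g′ → (f ⊛ g) ≋[ N ] (f′ ⊛ g′)
  ⊛-cong-≋[] f≋f′ g≋g′ n n≤N = sumTo-cong≤ n (λ k k≤n →
    cong₂ _*_ (f≋f′ k (ℕ.≤-trans k≤n n≤N)) (g≋g′ (n ∸ k) (ℕ.≤-trans (ℕ.m∸n≤m n k) n≤N)))

  inv-cong-≋[] : ∀ {g g′ N} → g 0 ≡ + 1 → g′ 0 ≡ + 1 → g ≋[ N ] g′ → inv g ≋[ N ] inv g′
  inv-cong-≋[] {g} {g′} {N} g0≡1 g′0≡1 g≋g′ = ≋[]-trans (≋⇒≋[] N expand) (≋[]-trans swap (≋⇒≋[] N contract))
    where
    open ≋-Reasoning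
    expand : inv g ≋ ((inv g ⊛ g′) ⊛ inv g′)
    expand = begin
      inv g                  ≈⟨ ⊛-identityʳ (inv g) ⟨
      inv g ⊛ oneS           ≈⟨ ⊛-congˡ (inv g) (⊛-inverseʳ g′ g′0≡1) ⟨
      inv g ⊛ (g′ ⊛ inv g′)  ≈⟨ ⊛-assoc (inv g) g′ (inv g′) ⟨
      (inv g ⊛ g′) ⊛ inv g′  ∎
    swap : ((inv g ⊛ g′) ⊛ inv g′) ≋[ N ] ((inv g ⊛ g) ⊛ inv g′)
    swap = ⊛-cong-≋[] {inv g ⊛ g′} {inv g ⊛ g} {inv g′} {inv g′}
             (⊛-cong-≋[] {inv g} {inv g} {g′} {g} (λ _ _ → refl) (≋[]-sym g≋g′)) (λ _ _ → refl)
    contract : ((inv g ⊛ g) ⊛ inv g′) ≋ inv g′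
    contract = ≋-trans (⊛-congʳ (inv g′) (⊛-inverseˡ g g0≡1)) (⊛-identityˡ (inv g′))

  mono-⊛-below : ∀ k h {n} → n < k → (mono k ⊛ h) n ≡ + 0
  mono-⊛-below k h {n} n<k rewrite mono-⊛ k h n | >⇒≤ᵇ-false n<k = refl

  ∸-≡ᵇ : ∀ {a n} b → a ≤ n → (n ∸ a ≡ᵇ b) ≡ (n ≡ᵇ a ℕ.+ b)
  ∸-≡ᵇ {zero}          b z≤n       = refl
  ∸-≡ᵇ {suc a} {suc n} b (s≤s a≤n) = ∸-≡ᵇ b a≤n

  mono-⊛-mono : ∀ a b → (mono a ⊛ mono b) ≋ mono (a ℕ.+ b)
  mono-⊛-mono a b n with a ℕ.≤? n
  ... | yes a≤n rewrite mono-⊛ a (mono b) n | ≤⇒≤ᵇ-true a≤n | ∸-≡ᵇ b a≤n = refl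
  ... | no  a≰n rewrite mono-⊛ a (mono b) n | >⇒≤ᵇ-false (ℕ.≰⇒> a≰n)
                      | ≢⇒≡ᵇ-false (ℕ.<⇒≢ (ℕ.<-≤-trans (ℕ.≰⇒> a≰n) (ℕ.m≤m+n a b))) = refl

  poch-head : ∀ {a} → a 0 ≡ + 0 → ∀ m → poch a m 0 ≡ + 1
  poch-head a0≡0 zero    = refl
  poch-head a0≡0 (suc m) = cong₂ (λ p c → p * (+ 1 + - (c * mono m 0))) (poch-head a0≡0 m) a0≡0

  poch-stable : ∀ {a} → a 0 ≡ + 0 → ∀ M → poch a (suc M) ≋[ M ] poch a M
  poch-stable {a} a0≡0 M =
    ≋[]-trans (⊛-cong-≋[] {poch a M} (λ _ _ → refl) lastFactor) (≋⇒≋[] M (⊛-identityʳ (poch a M)))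
    where
    shifted : (a ⊛ mono M) ≋[ M ] zeroS
    shifted k k≤M with ℕ.m≤n⇒m<n∨m≡n k≤M
    ... | inj₁ k<M = trans (⊛-comm a (mono M) k) (mono-⊛-below M a k<M)
    ... | inj₂ refl rewrite ⊛-comm a (mono k) k | mono-⊛ k a k | ≤⇒≤ᵇ-true (ℕ.≤-refl {k}) | ℕ.n∸n≡0 k = a0≡0
    lastFactor : (oneS ⊖ a ⊛ mono M) ≋[ M ] oneS
    lastFactor k k≤M = trans (cong (λ c → oneS k + - c) (shifted k k≤M)) (ℤ.+-identityʳ (oneS k))

  pochInf-≋[] : ∀ {a} → a 0 ≡ + 0 → ∀ N → pochInf a ≋[ N ] poch a (suc N)
  pochInf-≋[] {a} a0≡0 N k k≤N =
    trans (stable⇒≡diagonal P (poch-stable a0≡0) (ℕ.n≤1+n k))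
          (sym (stable⇒≡diagonal P (poch-stable a0≡0) (ℕ.m≤n⇒m≤1+n k≤N)))
    where
    P : ℕ → ℕ → ℤ
    P = poch a

  negPoch : ℕ → FPS
  negPoch = poch minusQ

  qPoch : ℕ → FPS
  qPoch = poch q

  negPoch-head : ∀ m → negPoch m 0 ≡ + 1
  negPoch-head = poch-head refl

  qPoch-head : ∀ m → qPoch m 0 ≡ + 1
  qPoch-head = poch-head refl

  negPoch-suc : ∀ m → negPoch (suc m) ≋ (negPoch m ⊛ (oneS ⊕ mono (suc m)))
  negPoch-suc m = ⊛-congˡ (negPoch m) (≋-trans
    (solve 3 (λ u x y → u :- (:- x) :* y := u :+ x :* y) (λ _ → refl) oneS q (mono m))
    (λ n → cong (λ c → oneS n + c) (mono-⊛-mono 1 m n)))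

  qPoch-suc : ∀ m → qPoch (suc m) ≋ (qPoch m ⊛ (oneS ⊖ mono (suc m)))
  qPoch-suc m = ⊛-congˡ (qPoch m) (λ n → cong (λ c → oneS n + - c) (mono-⊛-mono 1 m n))

  -- Ramanujan's σ(q) by Abel summation

  [2+m]C2 : ∀ m → suc (suc m) C 2 ≡ suc m C 2 ℕ.+ suc m
  [2+m]C2 m = trans (sym (nCk+nC[k+1]≡[n+1]C[k+1] (suc m) 1))
                    (trans (cong (ℕ._+ (suc m C 2)) (nC1≡n (suc m))) (ℕ.+-comm (suc m) _))

  sigmaTerm : ℕ → FPS
  sigmaTerm m = mono (suc m C 2) ⊘ negPoch m

  mexTerm : ℕ → FPS
  mexTerm m = mono (m C 2) ⊘ negPoch m

  mexTerm-telescopes : ∀ m → mexTerm (suc m) ≋ (sigmaTerm m ⊖ sigmaTerm (suc m))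
  mexTerm-telescopes m = ≋-sym (⊘-unique {g = negPoch (suc m)} (negPoch-head (suc m)) (begin
    (A ⊖ B) ⊛ negPoch (suc m)
      ≈⟨ solve 3 (λ a b g → (a :- b) :* g := a :* g :- b :* g) (λ _ → refl) A B (negPoch (suc m)) ⟩
    A ⊛ negPoch (suc m) ⊖ B ⊛ negPoch (suc m)
      ≈⟨ ⊕-cong (⊛-congˡ A (negPoch-suc m)) (negS-cong (⊘-⊛-cancel (mono (suc (suc m) C 2)) (negPoch-head (suc m)))) ⟩
    A ⊛ (negPoch m ⊛ X) ⊖ mono (suc (suc m) C 2)
      ≈⟨ ⊕-cong (≋-sym (⊛-assoc A (negPoch m) X))
                (negS-cong (≋-sym (≋-trans (mono-⊛-mono K (suc m)) (λ n → cong (λ e → mono e n) (sym ([2+m]C2 m)))))) ⟩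
    (A ⊛ negPoch m) ⊛ X ⊖ mono K ⊛ mono (suc m)
      ≈⟨ ⊕-cong (⊛-congʳ X (⊘-⊛-cancel (mono K) (negPoch-head m))) ≋-refl ⟩
    mono K ⊛ (oneS ⊕ mono (suc m)) ⊖ mono K ⊛ mono (suc m)
      ≈⟨ solve 3 (λ k u x → k :* (u :+ x) :- k :* x := k :* u) (λ _ → refl) (mono K) oneS (mono (suc m)) ⟩
    mono K ⊛ oneS
      ≈⟨ ⊛-identityʳ (mono K) ⟩
    mono K ∎))
    where
    open ≋-Reasoning
    K = suc m C 2
    A = sigmaTerm m
    B = sigmaTerm (suc m)
    X = oneS ⊕ mono (suc m)

  abel-summation : ∀ M n → sumTo (suc M) (λ m → + m * mexTerm m n)
                           ≡ sumTo M (λ m → sigmaTerm m n) - + suc M * sigmaTerm (suc M) n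
  abel-summation zero n =
    trans (cong (λ t → + 0 * mexTerm 0 n + + 1 * t) (mexTerm-telescopes 0 n))
          (rearrange (mexTerm 0 n) (sigmaTerm 0 n) (sigmaTerm 1 n))
    where
    rearrange : ∀ c a b → + 0 * c + + 1 * (a + - b) ≡ a - + 1 * b
    rearrange = solve-∀
  abel-summation (suc M) n =
    trans (cong₂ (λ s t → s + (+ 1 + + suc M) * t) (abel-summation M n) (mexTerm-telescopes (suc M) n))
          (rearrange (sumTo M (λ m → sigmaTerm m n)) (+ suc M) (sigmaTerm (suc M) n) (sigmaTerm (suc (suc M)) n))
    where
    rearrange : ∀ s a x y → s - a * x + (+ 1 + a) * (x + - y) ≡ s + x - (+ 1 + a) * y
    rearrange = solve-∀

  sigmaTerm-below : ∀ {j n} → n < j → sigmaTerm j n ≡ + 0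
  sigmaTerm-below {suc j} n<1+j = mono-⊛-below (suc (suc j) C 2) (inv (negPoch (suc j)))
    (ℕ.<-≤-trans n<1+j (ℕ.≤-trans (ℕ.m≤n+m (suc j) (suc j C 2)) (ℕ.≤-reflexive (sym ([2+m]C2 j)))))

  S1≋sigmaR : S1 ≋ sigmaR
  S1≋sigmaR n = begin
    sumTo (suc n) (λ m → (((+ m) · mono (m C 2)) ⊘ negPoch m) n)
      ≡⟨ sumTo-cong (suc n) (λ m → ·-⊛ (+ m) (mono (m C 2)) (inv (negPoch m)) n) ⟩
    sumTo (suc n) (λ m → + m * mexTerm m n)
      ≡⟨ abel-summation n n ⟩
    Σσ - + suc n * sigmaTerm (suc n) n
      ≡⟨ cong (λ t → Σσ - + suc n * t) last≡0 ⟩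
    Σσ - + suc n * + 0
      ≡⟨ cong (λ t → Σσ - t) (ℤ.*-zeroʳ (+ suc n)) ⟩
    Σσ + + 0
      ≡⟨ cong (λ t → Σσ + t) last≡0 ⟨
    Σσ + sigmaTerm (suc n) n ∎
    where
    open ≡-Reasoning
    Σσ = sumTo n (λ m → sigmaTerm m n)
    last≡0 = sigmaTerm-below (ℕ.n<1+n n)

open PowerSeries

module WordCounting where

  open import Data.Nat using (_+_)
  open import Data.List.Properties using (map-++)
  open import Data.Nat.ListAction.Properties using (sum-++)

  indicator : Bool → ℕ
  indicator b = if b then 1 else 0

  sumBelow : ℕ → (ℕ → ℕ) → ℕ
  sumBelow zero    h = 0
  sumBelow (suc n) h = sumBelow n h + h n

  sumBelow-cong< : ∀ n {h h′ : ℕ → ℕ} → (∀ k → k < n → h k ≡ h′ k) → sumBelow n h ≡ sumBelow n h′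
  sumBelow-cong< zero    e = refl
  sumBelow-cong< (suc n) e = cong₂ _+_ (sumBelow-cong< n (λ k k<n → e k (ℕ.m<n⇒m<1+n k<n))) (e n ℕ.≤-refl)

  sumBelow-cong : ∀ n {h h′ : ℕ → ℕ} → (∀ k → h k ≡ h′ k) → sumBelow n h ≡ sumBelow n h′
  sumBelow-cong n e = sumBelow-cong< n (λ k _ → e k)

  sumBelow-zero : ∀ n → sumBelow n (λ _ → 0) ≡ 0
  sumBelow-zero zero    = refl
  sumBelow-zero (suc n) = trans (ℕ.+-identityʳ _) (sumBelow-zero n)

  sumBelow-suc : ∀ n (h : ℕ → ℕ) → sumBelow (suc n) h ≡ h 0 + sumBelow n (h ∘ suc)
  sumBelow-suc zero    h = ℕ.+-comm 0 (h 0)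
  sumBelow-suc (suc n) h = trans (cong (_+ h (suc n)) (sumBelow-suc n h)) (ℕ.+-assoc (h 0) _ _)

  sumBelow-+ : ∀ n (h h′ : ℕ → ℕ) → sumBelow n (λ k → h k + h′ k) ≡ sumBelow n h + sumBelow n h′
  sumBelow-+ zero    h h′ = refl
  sumBelow-+ (suc n) h h′ =
    trans (cong (_+ (h n + h′ n)) (sumBelow-+ n h h′)) (+-interchange (sumBelow n h) (sumBelow n h′) (h n) (h′ n))
    where open CommutativeSemigroupProperties ℕ.+-commutativeSemigroup using () renaming (interchange to +-interchange)

  sumBelow-swap : ∀ m n (h : ℕ → ℕ → ℕ) →
    sumBelow m (λ i → sumBelow n (h i)) ≡ sumBelow n (λ j → sumBelow m (λ i → h i j))
  sumBelow-swap m zero    h = sumBelow-zero m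
  sumBelow-swap m (suc n) h =
    trans (sumBelow-+ m (λ i → sumBelow n (h i)) (λ i → h i n)) (cong (_+ sumBelow m (λ i → h i n)) (sumBelow-swap m n h))

  sumBelow-vanishing : ∀ {m n} (h : ℕ → ℕ) → m ≤ n → (∀ k → m ≤ k → h k ≡ 0) → sumBelow n h ≡ sumBelow m h
  sumBelow-vanishing {m} {n} h m≤n vanish with ℕ.m≤n⇒m<n∨m≡n m≤n
  ... | inj₂ refl = refl
  ... | inj₁ m<n with n
  ...   | suc n′ = trans (cong₂ _+_ (sumBelow-vanishing h (ℕ.≤-pred m<n) vanish) (vanish n′ (ℕ.≤-pred m<n)))
                         (ℕ.+-identityʳ _)

  sumOver : {X : Set} → List X → (X → ℕ) → ℕ
  sumOver xs f = sumℕ (map f xs)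

  sumOver-cong : ∀ {X : Set} (xs : List X) {f g : X → ℕ} → (∀ x → f x ≡ g x) → sumOver xs f ≡ sumOver xs g
  sumOver-cong []       e = refl
  sumOver-cong (x ∷ xs) e = cong₂ _+_ (e x) (sumOver-cong xs e)

  sumOver-zero : ∀ {X : Set} (xs : List X) → sumOver xs (λ _ → 0) ≡ 0
  sumOver-zero []       = refl
  sumOver-zero (x ∷ xs) = sumOver-zero xs

  sumOver-++ : ∀ {X : Set} (xs ys : List X) (f : X → ℕ) → sumOver (xs ++ ys) f ≡ sumOver xs f + sumOver ys f
  sumOver-++ xs ys f = trans (cong sumℕ (map-++ f xs ys)) (sum-++ (map f xs) (map f ys))

  sumOver-map : ∀ {X Y : Set} (xs : List X) (g : X → Y) (f : Y → ℕ) → sumOver (map g xs) f ≡ sumOver xs (f ∘ g)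
  sumOver-map []       g f = refl
  sumOver-map (x ∷ xs) g f = cong (f (g x) +_) (sumOver-map xs g f)

  sumOver-concatMap : ∀ {X Y : Set} (xs : List X) (g : X → List Y) (f : Y → ℕ) →
    sumOver (concatMap g xs) f ≡ sumOver xs (λ x → sumOver (g x) f)
  sumOver-concatMap []       g f = refl
  sumOver-concatMap (x ∷ xs) g f =
    trans (sumOver-++ (g x) (concatMap g xs) f) (cong (sumOver (g x) f +_) (sumOver-concatMap xs g f))

  sumOver-filter : ∀ {X : Set} {p : X → Bool} (P? : ∀ x → Dec (p x ≡ true)) (xs : List X) (f : X → ℕ) →
    sumOver (filter P? xs) f ≡ sumOver xs (λ x → if p x then f x else 0)
  sumOver-filter         P? []       f = refl
  sumOver-filter {p = p} P? (x ∷ xs) f with P? x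
  ... | yes px rewrite px = cong (f x +_) (sumOver-filter P? xs f)
  ... | no ¬px with p x
  ...   | true  = ⊥-elim (¬px refl)
  ...   | false = sumOver-filter P? xs f

  sumOver-applyUpTo : ∀ n (g h : ℕ → ℕ) → sumOver (applyUpTo g n) h ≡ sumBelow n (h ∘ g)
  sumOver-applyUpTo zero    g h = refl
  sumOver-applyUpTo (suc n) g h =
    trans (cong (h (g 0) +_) (sumOver-applyUpTo n (g ∘ suc) h)) (sym (sumBelow-suc n (h ∘ g)))

  sumOver-upTo : ∀ n (h : ℕ → ℕ) → sumOver (upTo n) h ≡ sumBelow n h
  sumOver-upTo n = sumOver-applyUpTo n id

  sumBelow-sumOver : ∀ {X : Set} m (xs : List X) (h : ℕ → X → ℕ) →
    sumBelow m (λ i → sumOver xs (h i)) ≡ sumOver xs (λ x → sumBelow m (λ i → h i x))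
  sumBelow-sumOver m []       h = sumBelow-zero m
  sumBelow-sumOver m (x ∷ xs) h =
    trans (sumBelow-+ m (λ i → h i x) (λ i → sumOver xs (h i))) (cong (sumBelow m (λ i → h i x) +_) (sumBelow-sumOver m xs h))

  length≡sumOver : ∀ {X : Set} (xs : List X) → length xs ≡ sumOver xs (λ _ → 1)
  length≡sumOver []       = refl
  length≡sumOver (x ∷ xs) = cong suc (length≡sumOver xs)

  sumOver-overpartitions : ∀ n (f : List Part → ℕ) →
    sumOver (overpartitions n) f
      ≡ sumBelow (suc n) (λ L → sumOver (words (alphabet n) L) (λ w → if isOverpartition n w then f w else 0))
  sumOver-overpartitions n f = trans filtered (trans (sumOver-concatMap (upTo (suc n)) (words (alphabet n)) _) (sumOver-upTo (suc n) _))
    where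
    filtered : sumOver (overpartitions n) f ≡ sumOver (candidates n) (λ w → if isOverpartition n w then f w else 0)
    -- The decision procedure used by overpartitions is local to its where-block; splitting on its
    -- test of the empty candidate exposes filter applied to it, so sumOver-filter can be used.
    filtered with 0 ≡ᵇ n
    ... | false = sumOver-filter _ (concatMap (words (alphabet n)) (applyUpTo suc n)) f
    ... | true  = cong (f [] +_) (sumOver-filter _ (concatMap (words (alphabet n)) (applyUpTo suc n)) f)

  sumOver-words-suc : ∀ (A : List Part) L (h : List Part → ℕ) →
    sumOver (words A (suc L)) h ≡ sumOver A (λ a → sumOver (words A L) (λ w → h (a ∷ w)))
  sumOver-words-suc A L h =
    trans (sumOver-concatMap A (λ a → map (a ∷_) (words A L)) h) (sumOver-cong A (λ a → sumOver-map (words A L) (a ∷_) h))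

  sumOver-alphabet : ∀ N (h : Part → ℕ) → sumOver (alphabet N) h ≡ sumBelow N (λ k → h (suc k , false) + h (suc k , true))
  sumOver-alphabet N h = trans (sumOver-concatMap (upTo N) (λ k → (suc k , false) ∷ (suc k , true) ∷ []) h)
    (trans (sumOver-upTo N _) (sumBelow-cong N (λ k → cong (h (suc k , false) +_) (ℕ.+-identityʳ _))))

  overlinedRun : ℕ → ℕ → List Part → Bool
  overlinedRun k zero    w = true
  overlinedRun k (suc i) w = occursOverlined k w ∧ overlinedRun (suc k) i w

  overlinedRun-suc : ∀ k i w → overlinedRun k (suc i) w ≡ overlinedRun k i w ∧ occursOverlined (k + i) w
  overlinedRun-suc k zero    w rewrite ℕ.+-identityʳ k = Bool.∧-comm (occursOverlined k w) true
  overlinedRun-suc k (suc i) w = begin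
    occursOverlined k w ∧ overlinedRun (suc k) (suc i) w
      ≡⟨ cong (occursOverlined k w ∧_) (overlinedRun-suc (suc k) i w) ⟩
    occursOverlined k w ∧ (overlinedRun (suc k) i w ∧ occursOverlined (suc k + i) w)
      ≡⟨ Bool.∧-assoc (occursOverlined k w) _ _ ⟨
    overlinedRun k (suc i) w ∧ occursOverlined (suc k + i) w
      ≡⟨ cong (λ m → overlinedRun k (suc i) w ∧ occursOverlined m w) (ℕ.+-suc k i) ⟨
    overlinedRun k (suc i) w ∧ occursOverlined (k + suc i) w ∎
    where open ≡-Reasoning

  overlinesUpTo : ℕ → List Part → Bool
  overlinesUpTo = overlinedRun 1

  overlinesUpTo-suc : ∀ j w → overlinesUpTo (suc j) w ≡ overlinesUpTo j w ∧ occursOverlined (suc j) w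
  overlinesUpTo-suc = overlinedRun-suc 1

  mexSearch≡ : ∀ fuel k w → mexSearch fuel k w ≡ k + sumBelow fuel (λ i → indicator (overlinedRun k (suc i) w))
  mexSearch≡ zero       k w = sym (ℕ.+-identityʳ k)
  mexSearch≡ (suc fuel) k w rewrite sumBelow-suc fuel (λ i → indicator (overlinedRun k (suc i) w)) with occursOverlined k w
  ... | true  = trans (mexSearch≡ fuel (suc k) w) (sym (ℕ.+-suc k _))
  ... | false = sym (trans (cong (k +_) (sumBelow-zero fuel)) (ℕ.+-identityʳ k))

  mexHat≡ : ∀ w → mexHat w ≡ sumBelow (2 + length w) (λ j → indicator (overlinesUpTo j w))
  mexHat≡ w = trans (mexSearch≡ (suc (length w)) 1 w) (sym (sumBelow-suc (suc (length w)) (λ j → indicator (overlinesUpTo j w))))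

  -- The part (y , f) respects the bound x; a part y = x may be overlined only if s
  -- (s = false when x is the preceding part of a word).
  canFollow : ℕ → Bool → ℕ → Bool → Bool
  canFollow x s y f = (y ≤ᵇ x) ∧ (if y ≡ᵇ x then s ∨ not f else true)

  headCanFollow : ℕ → Bool → List Part → Bool
  headCanFollow x s []            = true
  headCanFollow x s ((y , f) ∷ _) = canFollow x s y f

  fits : ℕ → Bool → ℕ → List Part → Bool
  fits x s n w = isOverpartition n w ∧ headCanFollow x s w

  wellOrdered-∷ : ∀ y f w → wellOrdered ((y , f) ∷ w) ≡ headCanFollow y false w ∧ wellOrdered w
  wellOrdered-∷ y f []            = refl
  wellOrdered-∷ y f ((z , g) ∷ w) = sym (Bool.∧-assoc (z ≤ᵇ y) _ _)

  suc≤ᵇsuc : ∀ a b → (suc a ≤ᵇ suc b) ≡ (a ≤ᵇ b)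
  suc≤ᵇsuc zero    b = refl
  suc≤ᵇsuc (suc a) b = refl

  +-≡ᵇ : ∀ y p n → (y + p ≡ᵇ n) ≡ (y ≤ᵇ n) ∧ (p ≡ᵇ n ∸ y)
  +-≡ᵇ zero    p n       = refl
  +-≡ᵇ (suc y) p zero    = refl
  +-≡ᵇ (suc y) p (suc n) = trans (+-≡ᵇ y p n) (cong (_∧ (p ≡ᵇ n ∸ y)) (sym (suc≤ᵇsuc y n)))

  fits-∷ : ∀ x s n y f w →
    fits x s n ((y , f) ∷ w) ≡ ((1 ≤ᵇ y) ∧ (y ≤ᵇ n) ∧ canFollow x s y f) ∧ fits y false (n ∸ y) w
  fits-∷ x s n y f w rewrite +-≡ᵇ y (partSum w) n | wellOrdered-∷ y f w =
    ∧-solve 7 (λ P L S A H O C → ((L ∙ S) ∙ ((P ∙ A) ∙ (H ∙ O))) ∙ C ⊜ (P ∙ L ∙ C) ∙ ((S ∙ A ∙ O) ∙ H)) refl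
      (1 ≤ᵇ y) (y ≤ᵇ n) (partSum w ≡ᵇ n ∸ y) (allPositive w) (headCanFollow y false w) (wellOrdered w) (canFollow x s y f)
    where
    open import Algebra.Solver.CommutativeMonoid Bool.∧-commutativeMonoid
      using (_⊜_) renaming (solve to ∧-solve; _⊕_ to _∙_)

  noDuplicateOverline : ∀ {z y k} g → z ≤ y → y ≤ k → T (if z ≡ᵇ y then not g else true) → g ∧ (z ≡ᵇ k) ≡ false
  noDuplicateOverline false _ _ _ = refl
  noDuplicateOverline {z} {y} {k} true z≤y y≤k firstOnly = ≢⇒≡ᵇ-false z≢k
    where
    z≢k : z ≢ k
    z≢k refl with z ≡ᵇ y | ℕ.≡⇒≡ᵇ z y (ℕ.≤-antisym z≤y y≤k)
    ... | true | _ = firstOnly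

  wellOrdered-overlined-below : ∀ {y f} w → T (wellOrdered ((y , f) ∷ w)) → ∀ {k} → y ≤ k → occursOverlined k w ≡ false
  wellOrdered-overlined-below []            _  _   = refl
  wellOrdered-overlined-below ((z , g) ∷ w) wo y≤k =
    cong₂ _∨_ (noDuplicateOverline g z≤y y≤k (proj₁ rest))
              (wellOrdered-overlined-below w (proj₂ rest) (ℕ.≤-trans z≤y y≤k))
    where
    split = Equivalence.to Bool.T-∧ wo
    z≤y = ℕ.≤ᵇ⇒≤ z _ (proj₁ split)
    rest = Equivalence.to Bool.T-∧ (proj₂ split)

  wellOrdered-tail : ∀ {y f} w → T (wellOrdered ((y , f) ∷ w)) → T (wellOrdered w)
  wellOrdered-tail {y} {f} w wo = proj₂ (Equivalence.to (Bool.T-∧ {headCanFollow y false w}) (subst T (wellOrdered-∷ y f w) wo))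

  fits⇒wellOrdered-∷ : ∀ {y n} f w → T (fits y false n w) → T (wellOrdered ((y , f) ∷ w))
  fits⇒wellOrdered-∷ {y} {n} f w fw = subst T (sym (wellOrdered-∷ y f w)) (Equivalence.from Bool.T-∧ (proj₂ split , wo))
    where
    split = Equivalence.to (Bool.T-∧ {isOverpartition n w}) fw
    wo = proj₂ (Equivalence.to Bool.T-∧ (proj₂ (Equivalence.to (Bool.T-∧ {partSum w ≡ᵇ n}) (proj₁ split))))

  -- The requirement that 1, …, j occur overlined, passed to the tail once the first part is (y , f);
  -- nothing when it can no longer be met.
  tailRequirement : ℕ → ℕ → Bool → Maybe ℕ
  tailRequirement j y f = if j <ᵇ y then just j else if (j ≡ᵇ y) ∧ f then just (pred j) else nothing

  module _ {y : ℕ} {f : Bool} {w : List Part} (noLarger : ∀ {i} → y ≤ i → occursOverlined i w ≡ false) where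

    occursOverlined-∷-≢ : ∀ {i} → y ≢ i → occursOverlined i ((y , f) ∷ w) ≡ occursOverlined i w
    occursOverlined-∷-≢ y≢i rewrite ≢⇒≡ᵇ-false y≢i | Bool.∧-zeroʳ f = refl

    overlinesUpTo-∷-below : ∀ {j} → j < y → overlinesUpTo j ((y , f) ∷ w) ≡ overlinesUpTo j w
    overlinesUpTo-∷-below {zero}  _     = refl
    overlinesUpTo-∷-below {suc j} 1+j<y = begin
      overlinesUpTo (suc j) ((y , f) ∷ w)
        ≡⟨ overlinesUpTo-suc j _ ⟩
      overlinesUpTo j ((y , f) ∷ w) ∧ occursOverlined (suc j) ((y , f) ∷ w)
        ≡⟨ cong₂ _∧_ (overlinesUpTo-∷-below (ℕ.<-trans (ℕ.n<1+n j) 1+j<y)) (occursOverlined-∷-≢ (ℕ.>⇒≢ 1+j<y)) ⟩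
      overlinesUpTo j w ∧ occursOverlined (suc j) w
        ≡⟨ overlinesUpTo-suc j w ⟨
      overlinesUpTo (suc j) w ∎
      where open ≡-Reasoning

    overlinesUpTo-∷-above : ∀ {j} → y < j → overlinesUpTo j ((y , f) ∷ w) ≡ false
    overlinesUpTo-∷-above {suc j} y<1+j = begin
      overlinesUpTo (suc j) ((y , f) ∷ w)
        ≡⟨ overlinesUpTo-suc j _ ⟩
      overlinesUpTo j ((y , f) ∷ w) ∧ occursOverlined (suc j) ((y , f) ∷ w)
        ≡⟨ cong (overlinesUpTo j ((y , f) ∷ w) ∧_)
                (trans (occursOverlined-∷-≢ (ℕ.<⇒≢ y<1+j)) (noLarger (ℕ.<⇒≤ y<1+j))) ⟩
      overlinesUpTo j ((y , f) ∷ w) ∧ false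
        ≡⟨ Bool.∧-zeroʳ _ ⟩
      false ∎
      where open ≡-Reasoning

  overlinesUpTo-∷-at : ∀ {j f w} → (∀ {i} → suc j ≤ i → occursOverlined i w ≡ false) →
    overlinesUpTo (suc j) ((suc j , f) ∷ w) ≡ f ∧ overlinesUpTo j w
  overlinesUpTo-∷-at {j} {f} {w} noLarger = begin
    overlinesUpTo (suc j) ((suc j , f) ∷ w)
      ≡⟨ overlinesUpTo-suc j _ ⟩
    overlinesUpTo j ((suc j , f) ∷ w) ∧ occursOverlined (suc j) ((suc j , f) ∷ w)
      ≡⟨ cong₂ _∧_ (overlinesUpTo-∷-below noLarger (ℕ.n<1+n j)) occursSelf ⟩
    overlinesUpTo j w ∧ f
      ≡⟨ Bool.∧-comm _ f ⟩
    f ∧ overlinesUpTo j w ∎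
    where
    open ≡-Reasoning
    occursSelf : occursOverlined (suc j) ((suc j , f) ∷ w) ≡ f
    occursSelf rewrite ≡ᵇ-refl j | noLarger (ℕ.≤-refl {suc j}) | Bool.∧-identityʳ f = Bool.∨-identityʳ f

  overlinesUpTo-∷ : ∀ {k f w} → (∀ {i} → suc k ≤ i → occursOverlined i w ≡ false) → ∀ j →
    overlinesUpTo j ((suc k , f) ∷ w) ≡ maybe′ (λ i → overlinesUpTo i w) false (tailRequirement j (suc k) f)
  overlinesUpTo-∷ {k} {f} noLarger j with ℕ.<-cmp j (suc k)
  ... | tri< j<y _ _ rewrite <⇒<ᵇ-true j<y = overlinesUpTo-∷-below noLarger j<y
  ... | tri> j≮y j≢y y<j rewrite ≮⇒<ᵇ-false j≮y | ≢⇒≡ᵇ-false j≢y = overlinesUpTo-∷-above noLarger y<j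
  ... | tri≈ j≮y refl _ rewrite ≮⇒<ᵇ-false j≮y | ≡ᵇ-refl k with f
  ...   | true  = overlinesUpTo-∷-at noLarger
  ...   | false = overlinesUpTo-∷-at noLarger

  admissible : ℕ → Bool → ℕ → ℕ → List Part → Bool
  admissible x s n j w = fits x s n w ∧ overlinesUpTo j w

  firstPartRequirement : ℕ → Bool → ℕ → ℕ → ℕ → Bool → Maybe ℕ
  firstPartRequirement x s n j y f = if (y ≤ᵇ n) ∧ canFollow x s y f then tailRequirement j y f else nothing

  maybe′-zero : ∀ (m : Maybe ℕ) → maybe′ (λ _ → 0) 0 m ≡ 0
  maybe′-zero (just _) = refl
  maybe′-zero nothing  = refl

  indicator-guarded : ∀ g b c (c′ : ℕ → Bool) (t : Maybe ℕ) → (b ≡ true → c ≡ maybe′ c′ false t) →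
    indicator ((g ∧ b) ∧ c) ≡ maybe′ (λ i → indicator (b ∧ c′ i)) 0 (if g then t else nothing)
  indicator-guarded g     false c c′ t _ rewrite Bool.∧-zeroʳ g = sym (maybe′-zero (if g then t else nothing))
  indicator-guarded false true  c c′ t _ = refl
  indicator-guarded true  true  c c′ t c≡ rewrite c≡ refl with t
  ... | just i  = refl
  ... | nothing = refl

  admissible-∷ : ∀ x s n j k f w →
    indicator (admissible x s n j ((suc k , f) ∷ w))
      ≡ maybe′ (λ i → indicator (admissible (suc k) false (n ∸ suc k) i w)) 0 (firstPartRequirement x s n j (suc k) f)
  admissible-∷ x s n j k f w =
    trans (cong (λ b → indicator (b ∧ overlinesUpTo j ((suc k , f) ∷ w))) (fits-∷ x s n (suc k) f w))
          (indicator-guarded ((suc k ≤ᵇ n) ∧ canFollow x s (suc k) f) (fits (suc k) false (n ∸ suc k) w)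
            (overlinesUpTo j ((suc k , f) ∷ w)) (λ i → overlinesUpTo i w) (tailRequirement j (suc k) f)
            (λ fitsTail → overlinesUpTo-∷
              (wellOrdered-overlined-below w (fits⇒wellOrdered-∷ f w (Equivalence.from Bool.T-≡ fitsTail))) j))

  emptyCount : ℕ → ℕ → ℕ
  emptyCount n j = indicator ((n ≡ᵇ 0) ∧ (j ≡ᵇ 0))

  -- Number of admissible words with at most M parts; M is fuel, irrelevant once M ≥ n (admissibleCount-stable).
  mutual
    admissibleCount : ℕ → ℕ → ℕ → Bool → ℕ → ℕ
    admissibleCount zero    n x s j = emptyCount n j
    admissibleCount (suc M) n x s j =
      emptyCount n j + sumBelow x (λ k → firstPartCount M n x s j (suc k) false + firstPartCount M n x s j (suc k) true)

    firstPartCount : ℕ → ℕ → ℕ → Bool → ℕ → ℕ → Bool → ℕ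
    firstPartCount M n x s j y f = maybe′ (admissibleCount M (n ∸ y) y false) 0 (firstPartRequirement x s n j y f)

  wordCount : ℕ → ℕ → ℕ → ℕ → Bool → ℕ → ℕ
  wordCount N M n x s j = sumBelow (suc M) (λ L → sumOver (words (alphabet N) L) (indicator ∘ admissible x s n j))

  admissible-[] : ∀ x s n j → indicator (admissible x s n j []) ≡ emptyCount n j
  admissible-[] x s zero    zero    = refl
  admissible-[] x s zero    (suc j) = refl
  admissible-[] x s (suc n) j       = refl

  maybe′-cong : ∀ {R R′ : ℕ → ℕ} → (∀ i → R i ≡ R′ i) → ∀ m → maybe′ R 0 m ≡ maybe′ R′ 0 m
  maybe′-cong e (just i) = e i
  maybe′-cong e nothing  = refl

  sumOver-maybe′ : ∀ {X : Set} (xs : List X) (r : X → ℕ → ℕ) m →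
    sumOver xs (λ x → maybe′ (r x) 0 m) ≡ maybe′ (λ i → sumOver xs (λ x → r x i)) 0 m
  sumOver-maybe′ xs r (just i) = refl
  sumOver-maybe′ xs r nothing  = sumOver-zero xs

  sumBelow-maybe′ : ∀ M (r : ℕ → ℕ → ℕ) m →
    sumBelow M (λ L → maybe′ (r L) 0 m) ≡ maybe′ (λ i → sumBelow M (λ L → r L i)) 0 m
  sumBelow-maybe′ M r (just i) = refl
  sumBelow-maybe′ M r nothing  = sumBelow-zero M

  firstPartCount-beyond : ∀ M n x s j k f → x ≤ k → firstPartCount M n x s j (suc k) f ≡ 0
  firstPartCount-beyond M n x s j k f x≤k rewrite >⇒≤ᵇ-false {suc k} {x} (s≤s x≤k) | Bool.∧-zeroʳ (suc k ≤ᵇ n) = refl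

  wordCount≡admissibleCount : ∀ N M n x s j → x ≤ N → wordCount N M n x s j ≡ admissibleCount M n x s j
  wordCount≡admissibleCount N zero    n x s j _   = trans (ℕ.+-identityʳ _) (admissible-[] x s n j)
  wordCount≡admissibleCount N (suc M) n x s j x≤N = begin
    sumBelow (suc (suc M)) W
      ≡⟨ sumBelow-suc (suc M) W ⟩
    W 0 + sumBelow (suc M) (W ∘ suc)
      ≡⟨ cong₂ _+_ (trans (ℕ.+-identityʳ _) (admissible-[] x s n j)) longerWords ⟩
    emptyCount n j + sumBelow x (λ k → firstPartCount M n x s j (suc k) false + firstPartCount M n x s j (suc k) true) ∎
    where
    open ≡-Reasoning
    A = alphabet N
    W : ℕ → ℕ
    W L = sumOver (words A L) (indicator ∘ admissible x s n j)
    startingWith : Part → ℕ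
    startingWith a = sumBelow (suc M) (λ L → sumOver (words A L) (λ w → indicator (admissible x s n j (a ∷ w))))
    startingWith≡ : ∀ k → k < N → ∀ f → startingWith (suc k , f) ≡ firstPartCount M n x s j (suc k) f
    startingWith≡ k k<N f = begin
      startingWith (suc k , f)
        ≡⟨ sumBelow-cong (suc M) (λ L → sumOver-cong (words A L) (λ w → admissible-∷ x s n j k f w)) ⟩
      sumBelow (suc M) (λ L → sumOver (words A L) (λ w → maybe′ (λ i → tails i w) 0 r))
        ≡⟨ sumBelow-cong (suc M) (λ L → sumOver-maybe′ (words A L) (λ w i → tails i w) r) ⟩
      sumBelow (suc M) (λ L → maybe′ (λ i → sumOver (words A L) (tails i)) 0 r)
        ≡⟨ sumBelow-maybe′ (suc M) (λ L i → sumOver (words A L) (tails i)) r ⟩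
      maybe′ (λ i → wordCount N M (n ∸ suc k) (suc k) false i) 0 r
        ≡⟨ maybe′-cong (λ i → wordCount≡admissibleCount N M (n ∸ suc k) (suc k) false i k<N) r ⟩
      firstPartCount M n x s j (suc k) f ∎
      where
      r = firstPartRequirement x s n j (suc k) f
      tails : ℕ → List Part → ℕ
      tails i w = indicator (admissible (suc k) false (n ∸ suc k) i w)
    longerWords : sumBelow (suc M) (W ∘ suc)
                ≡ sumBelow x (λ k → firstPartCount M n x s j (suc k) false + firstPartCount M n x s j (suc k) true)
    longerWords = begin
      sumBelow (suc M) (W ∘ suc)
        ≡⟨ sumBelow-cong (suc M) (λ L → sumOver-words-suc A L (indicator ∘ admissible x s n j)) ⟩
      sumBelow (suc M) (λ L → sumOver A (λ a → sumOver (words A L) (λ w → indicator (admissible x s n j (a ∷ w)))))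
        ≡⟨ sumBelow-sumOver (suc M) A (λ L a → sumOver (words A L) (λ w → indicator (admissible x s n j (a ∷ w)))) ⟩
      sumOver A startingWith
        ≡⟨ sumOver-alphabet N startingWith ⟩
      sumBelow N (λ k → startingWith (suc k , false) + startingWith (suc k , true))
        ≡⟨ sumBelow-cong< N (λ k k<N → cong₂ _+_ (startingWith≡ k k<N false) (startingWith≡ k k<N true)) ⟩
      sumBelow N (λ k → firstPartCount M n x s j (suc k) false + firstPartCount M n x s j (suc k) true)
        ≡⟨ sumBelow-vanishing _ x≤N (λ k x≤k → cong₂ _+_ (firstPartCount-beyond M n x s j k false x≤k)
                                                            (firstPartCount-beyond M n x s j k true x≤k)) ⟩
      sumBelow x (λ k → firstPartCount M n x s j (suc k) false + firstPartCount M n x s j (suc k) true) ∎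

  headCanFollow-sum : ∀ {n} w → partSum w ≡ n → headCanFollow n true w ≡ true
  headCanFollow-sum []            _    = refl
  headCanFollow-sum ((y , f) ∷ w) refl rewrite ≤⇒≤ᵇ-true (ℕ.m≤m+n y (partSum w)) with y ≡ᵇ y + partSum w
  ... | true  = refl
  ... | false = refl

  fits-top : ∀ n w → fits n true n w ≡ isOverpartition n w
  fits-top n w with partSum w ≡ᵇ n in sum≡n
  ... | false = refl
  ... | true rewrite headCanFollow-sum w (≡ᵇ-true⇒≡ sum≡n) = Bool.∧-identityʳ _

  length≤partSum : ∀ w → T (allPositive w) → length w ≤ partSum w
  length≤partSum []            _  = z≤n
  length≤partSum ((a , f) ∷ w) ap = ℕ.+-mono-≤ (ℕ.≤ᵇ⇒≤ 1 a (proj₁ split)) (length≤partSum w (proj₂ split))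
    where split = Equivalence.to (Bool.T-∧ {1 ≤ᵇ a}) ap

  overlinesUpTo-length : ∀ w → T (wellOrdered w) → ∀ {j} → T (overlinesUpTo j w) → j ≤ length w
  overlinesUpTo-length w             wo {zero}  _  = z≤n
  overlinesUpTo-length ((y , f) ∷ w) wo {suc j} ov with ℕ.<-cmp (suc j) y
  ... | tri< 1+j<y _ _ =
    ℕ.m≤n⇒m≤1+n (overlinesUpTo-length w (wellOrdered-tail w wo) (subst T (overlinesUpTo-∷-below noLarger 1+j<y) ov))
    where noLarger = wellOrdered-overlined-below w wo
  ... | tri> _ _ y<1+j = ⊥-elim (subst T (overlinesUpTo-∷-above noLarger y<1+j) ov)
    where noLarger = wellOrdered-overlined-below w wo
  ... | tri≈ _ refl _ =
    s≤s (overlinesUpTo-length w (wellOrdered-tail w wo)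
                               (proj₂ (Equivalence.to (Bool.T-∧ {f}) (subst T (overlinesUpTo-∷-at noLarger) ov))))
    where noLarger = wellOrdered-overlined-below w wo

  isOverpartition-as-admissible : ∀ n w → indicator (isOverpartition n w) ≡ indicator (admissible n true n 0 w)
  isOverpartition-as-admissible n w = cong indicator (trans (sym (fits-top n w)) (sym (Bool.∧-identityʳ _)))

  mexHat-as-admissible : ∀ n w →
    (if isOverpartition n w then mexHat w else 0) ≡ sumBelow (2 + n) (λ j → indicator (admissible n true n j w))
  mexHat-as-admissible n w = trans onOverpartitions
    (sumBelow-cong (2 + n) (λ j → cong (λ b → indicator (b ∧ overlinesUpTo j w)) (sym (fits-top n w))))
    where
    onOverpartitions : (if isOverpartition n w then mexHat w else 0)
                     ≡ sumBelow (2 + n) (λ j → indicator (isOverpartition n w ∧ overlinesUpTo j w))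
    onOverpartitions with isOverpartition n w in isOP
    ... | false = sym (sumBelow-zero (2 + n))
    ... | true  = trans (mexHat≡ w) (sym (sumBelow-vanishing _ (s≤s (s≤s length≤n)) beyond))
      where
      split = Equivalence.to (Bool.T-∧ {partSum w ≡ᵇ n}) (Equivalence.from Bool.T-≡ isOP)
      rest = Equivalence.to (Bool.T-∧ {allPositive w}) (proj₂ split)
      length≤n : length w ≤ n
      length≤n = subst (length w ≤_) (ℕ.≡ᵇ⇒≡ _ n (proj₁ split)) (length≤partSum w (proj₁ rest))
      beyond : ∀ j → 2 + length w ≤ j → indicator (overlinesUpTo j w) ≡ 0
      beyond j 2+len≤j with overlinesUpTo j w in ov
      ... | false = refl
      ... | true  = ⊥-elim (ℕ.<-irrefl refl (ℕ.≤-trans (ℕ.n≤1+n _)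
                      (ℕ.≤-trans 2+len≤j (overlinesUpTo-length w (proj₂ rest) (Equivalence.from Bool.T-≡ ov)))))

  pbar≡admissibleCount : ∀ k → pbar k ≡ admissibleCount k k k true 0
  pbar≡admissibleCount k = begin
    length (overpartitions k)
      ≡⟨ length≡sumOver (overpartitions k) ⟩
    sumOver (overpartitions k) (λ _ → 1)
      ≡⟨ sumOver-overpartitions k (λ _ → 1) ⟩
    sumBelow (suc k) (λ L → sumOver (words (alphabet k) L) (indicator ∘ isOverpartition k))
      ≡⟨ sumBelow-cong (suc k) (λ L → sumOver-cong (words (alphabet k) L) (isOverpartition-as-admissible k)) ⟩
    wordCount k k k k true 0
      ≡⟨ wordCount≡admissibleCount k k k k true 0 ℕ.≤-refl ⟩
    admissibleCount k k k true 0 ∎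
    where open ≡-Reasoning

  sumOver-mexHat : ∀ n → sumOver (overpartitions n) mexHat ≡ sumBelow (2 + n) (λ j → admissibleCount n n n true j)
  sumOver-mexHat n = begin
    sumOver (overpartitions n) mexHat
      ≡⟨ sumOver-overpartitions n mexHat ⟩
    sumBelow (suc n) (λ L → sumOver (words A L) (λ w → if isOverpartition n w then mexHat w else 0))
      ≡⟨ sumBelow-cong (suc n) (λ L → sumOver-cong (words A L) (mexHat-as-admissible n)) ⟩
    sumBelow (suc n) (λ L → sumOver (words A L) (λ w → sumBelow (2 + n) (λ j → indicator (admissible n true n j w))))
      ≡⟨ sumBelow-cong (suc n) (λ L → sumBelow-sumOver (2 + n) (words A L) (λ j → indicator ∘ admissible n true n j)) ⟨
    sumBelow (suc n) (λ L → sumBelow (2 + n) (λ j → sumOver (words A L) (indicator ∘ admissible n true n j)))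
      ≡⟨ sumBelow-swap (suc n) (2 + n) (λ L j → sumOver (words A L) (indicator ∘ admissible n true n j)) ⟩
    sumBelow (2 + n) (λ j → wordCount n n n n true j)
      ≡⟨ sumBelow-cong (2 + n) (λ j → wordCount≡admissibleCount n n n n true j ℕ.≤-refl) ⟩
    sumBelow (2 + n) (λ j → admissibleCount n n n true j) ∎
    where
    open ≡-Reasoning
    A = alphabet n

  admissibleCount-suc : ∀ M n x s j → n ≤ M → admissibleCount (suc M) n x s j ≡ admissibleCount M n x s j
  admissibleCount-suc zero    zero    x s j _ = trans (cong (emptyCount 0 j +_) (sumBelow-zero x)) (ℕ.+-identityʳ _)
  admissibleCount-suc (suc M) n       x s j n≤1+M =
    cong (emptyCount n j +_) (sumBelow-cong x (λ k → cong₂ _+_ (shorter k false) (shorter k true)))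
    where
    shorter : ∀ k f → firstPartCount (suc M) n x s j (suc k) f ≡ firstPartCount M n x s j (suc k) f
    shorter k f = maybe′-cong (λ i → admissibleCount-suc M (n ∸ suc k) (suc k) false i (ℕ.∸-mono n≤1+M (s≤s z≤n)))
                              (firstPartRequirement x s n j (suc k) f)

  admissibleCount-stable : ∀ {M n} x s j → n ≤ M → admissibleCount M n x s j ≡ admissibleCount n n x s j
  admissibleCount-stable x s j = stable⇒≡diagonal (λ M n → admissibleCount M n x s j) (λ M n → admissibleCount-suc M n x s j)

  canFollow-below : ∀ {k x} s f → k < x → canFollow (suc x) s (suc k) f ≡ canFollow x true (suc k) f
  canFollow-below {k} {x} s f k<x
    rewrite ≤⇒≤ᵇ-true (ℕ.<⇒≤ (s≤s k<x)) | ≢⇒≡ᵇ-false (ℕ.<⇒≢ (s≤s k<x)) | ≤⇒≤ᵇ-true k<x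
    with suc k ≡ᵇ x
  ... | true  = refl
  ... | false = refl

  canFollow-top : ∀ x s f → canFollow x s x f ≡ s ∨ not f
  canFollow-top x s f rewrite ≤⇒≤ᵇ-true (ℕ.≤-refl {x}) | ≡ᵇ-refl x = refl

  admissibleCount-largest : ∀ M n x s j →
    admissibleCount (suc M) n (suc x) s j
      ≡ admissibleCount (suc M) n x true j
          + (firstPartCount M n (suc x) s j (suc x) false + firstPartCount M n (suc x) s j (suc x) true)
  admissibleCount-largest M n x s j =
    trans (cong (λ t → emptyCount n j + (t + largest))
                (sumBelow-cong< x (λ k k<x → cong₂ _+_ (smaller k k<x false) (smaller k k<x true))))
          (sym (ℕ.+-assoc (emptyCount n j) _ _))
    where
    largest = firstPartCount M n (suc x) s j (suc x) false + firstPartCount M n (suc x) s j (suc x) true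
    smaller : ∀ k → k < x → ∀ f → firstPartCount M n (suc x) s j (suc k) f ≡ firstPartCount M n x true j (suc k) f
    smaller k k<x f rewrite canFollow-below s f k<x = refl

open WordCounting

module BoundedOverpartitions where

  open import Data.Integer as ℤ using (ℤ; +_; _+_; _*_)
  import Data.Integer.Properties as ℤ

  -- Overpartitions with parts bounded by (x , s) in the sense of canFollow, in which 1, …, j occur overlined.
  boundedGF : ℕ → Bool → ℕ → FPS
  boundedGF x s j n = + admissibleCount n n x s j

  -- Up to the factor q^(x+1), the words counted by boundedGF (suc x) s j whose first part is x + 1.
  largestPartCount : Bool → ℕ → ℕ → Bool → ℕ → ℕ
  largestPartCount s j x f m =
    if s ∨ not f then maybe′ (admissibleCount m m (suc x) false) 0 (tailRequirement j (suc x) f) else 0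

  largestPartGF : Bool → ℕ → ℕ → FPS
  largestPartGF s j x m = + (largestPartCount s j x false m ℕ.+ largestPartCount s j x true m)

  firstPartCount-largest : ∀ n x s j f →
    firstPartCount n (suc n) (suc x) s j (suc x) f ≡ (if suc x ≤ᵇ suc n then largestPartCount s j x f (n ∸ x) else 0)
  firstPartCount-largest n x s j f rewrite canFollow-top (suc x) s f with suc x ≤ᵇ suc n
  ... | false = refl
  ... | true with s ∨ not f
  ...   | false = refl
  ...   | true  = maybe′-cong (λ i → admissibleCount-stable (suc x) false i (ℕ.m∸n≤m n x)) (tailRequirement j (suc x) f)

  boundedGF-suc : ∀ x s j → boundedGF (suc x) s j ≋ (boundedGF x true j ⊕ mono (suc x) ⊛ largestPartGF s j x)
  boundedGF-suc x s j zero    = sym (ℤ.+-identityʳ _)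
  boundedGF-suc x s j (suc n) = begin
    + admissibleCount (suc n) (suc n) (suc x) s j
      ≡⟨ cong +_ (admissibleCount-largest n (suc n) x s j) ⟩
    boundedGF x true j (suc n) + + (top false ℕ.+ top true)
      ≡⟨ cong (λ t → boundedGF x true j (suc n) + t) largest ⟩
    boundedGF x true j (suc n) + (mono (suc x) ⊛ largestPartGF s j x) (suc n) ∎
    where
    open ≡-Reasoning
    top : Bool → ℕ
    top = firstPartCount n (suc n) (suc x) s j (suc x)
    largest : + (top false ℕ.+ top true) ≡ (mono (suc x) ⊛ largestPartGF s j x) (suc n)
    largest rewrite mono-⊛ (suc x) (largestPartGF s j x) (suc n)
                  | firstPartCount-largest n x s j false | firstPartCount-largest n x s j true with suc x ≤ᵇ suc n
    ... | false = refl
    ... | true  = refl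

  largestPartGF-false-below : ∀ {j x} → j ≤ x → largestPartGF false j x ≋ boundedGF (suc x) false j
  largestPartGF-false-below j≤x m rewrite <⇒<ᵇ-true (s≤s j≤x) = cong +_ (ℕ.+-identityʳ _)

  largestPartGF-true-below : ∀ {j x} → j ≤ x → largestPartGF true j x ≋ (boundedGF (suc x) false j ⊕ boundedGF (suc x) false j)
  largestPartGF-true-below j≤x m rewrite <⇒<ᵇ-true (s≤s j≤x) = refl

  largestPartGF-true-top : ∀ x → largestPartGF true (suc x) x ≋ boundedGF (suc x) false x
  largestPartGF-true-top x m rewrite ≮⇒<ᵇ-false (ℕ.<-irrefl {suc x} refl) | ≡ᵇ-refl x = refl

  largestPartGF-beyond : ∀ s {j x} → suc x < j → largestPartGF s j x ≋ zeroS
  largestPartGF-beyond s 1+x<j m rewrite ≮⇒<ᵇ-false (ℕ.<⇒≯ 1+x<j) | ≢⇒≡ᵇ-false (ℕ.>⇒≢ 1+x<j) with s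
  ... | true  = refl
  ... | false = refl

  boundedGF-beyond : ∀ b {j} → b < j → boundedGF b true j ≋ zeroS
  boundedGF-beyond zero    {suc j} _ zero    = refl
  boundedGF-beyond zero    {suc j} _ (suc n) = refl
  boundedGF-beyond (suc b) {j}     1+b<j = begin
    boundedGF (suc b) true j                            ≈⟨ boundedGF-suc b true j ⟩
    boundedGF b true j ⊕ mono (suc b) ⊛ largestPartGF true j b
      ≈⟨ ⊕-cong (boundedGF-beyond b (ℕ.<-trans (ℕ.n<1+n b) 1+b<j))
                (⊛-congˡ (mono (suc b)) (largestPartGF-beyond true 1+b<j)) ⟩
    zeroS ⊕ mono (suc b) ⊛ zeroS                        ≈⟨ ⊕-identityˡ _ ⟩
    mono (suc b) ⊛ zeroS                                ≈⟨ ⊛-zeroʳ (mono (suc b)) ⟩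
    zeroS                                               ∎
    where open ≋-Reasoning

  boundedGF-false-step : ∀ {j x} → j ≤ x → (boundedGF (suc x) false j ⊛ (oneS ⊖ mono (suc x))) ≋ boundedGF x true j
  boundedGF-false-step {j} {x} j≤x = begin
    g ⊛ (oneS ⊖ m)        ≈⟨ solve 3 (λ g u m → g :* (u :- m) := g :* u :- m :* g) (λ _ → refl) g oneS m ⟩
    g ⊛ oneS ⊖ m ⊛ g      ≈⟨ ⊕-cong (≋-trans (⊛-identityʳ g) unfold) (≋-refl {negS (m ⊛ g)}) ⟩
    (g′ ⊕ m ⊛ g) ⊖ m ⊛ g  ≈⟨ solve 3 (λ g′ m g → (g′ :+ m :* g) :- m :* g := g′) (λ _ → refl) g′ m g ⟩
    g′                    ∎
    where
    open ≋-Reasoning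
    g = boundedGF (suc x) false j
    g′ = boundedGF x true j
    m = mono (suc x)
    unfold : g ≋ (g′ ⊕ m ⊛ g)
    unfold = ≋-trans (boundedGF-suc x false j) (⊕-cong (≋-refl {g′}) (⊛-congˡ m (largestPartGF-false-below j≤x)))

  boundedGF-true-step : ∀ {j x} → j ≤ x →
    (boundedGF (suc x) true j ⊛ (oneS ⊖ mono (suc x))) ≋ (boundedGF x true j ⊛ (oneS ⊕ mono (suc x)))
  boundedGF-true-step {j} {x} j≤x = begin
    gT ⊛ (oneS ⊖ m)
      ≈⟨ ⊛-congʳ (oneS ⊖ m)
           (≋-trans (boundedGF-suc x true j) (⊕-cong (≋-refl {g′}) (⊛-congˡ m (largestPartGF-true-below j≤x)))) ⟩
    (g′ ⊕ m ⊛ (gF ⊕ gF)) ⊛ (oneS ⊖ m)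
      ≈⟨ solve 4 (λ g′ m gF u → (g′ :+ m :* (gF :+ gF)) :* (u :- m)
                               := g′ :* (u :- m) :+ m :* (gF :* (u :- m)) :+ m :* (gF :* (u :- m)))
           (λ _ → refl) g′ m gF oneS ⟩
    g′ ⊛ (oneS ⊖ m) ⊕ m ⊛ (gF ⊛ (oneS ⊖ m)) ⊕ m ⊛ (gF ⊛ (oneS ⊖ m))
      ≈⟨ ⊕-cong (⊕-cong (≋-refl {g′ ⊛ (oneS ⊖ m)}) (⊛-congˡ m (boundedGF-false-step j≤x)))
                (⊛-congˡ m (boundedGF-false-step j≤x)) ⟩
    g′ ⊛ (oneS ⊖ m) ⊕ m ⊛ g′ ⊕ m ⊛ g′
      ≈⟨ solve 3 (λ g′ m u → g′ :* (u :- m) :+ m :* g′ :+ m :* g′ := g′ :* (u :+ m)) (λ _ → refl) g′ m oneS ⟩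
    g′ ⊛ (oneS ⊕ m) ∎
    where
    open ≋-Reasoning
    gT = boundedGF (suc x) true j
    gF = boundedGF (suc x) false j
    g′ = boundedGF x true j
    m = mono (suc x)

  boundedGF-top-step : ∀ x → (boundedGF (suc x) true (suc x) ⊛ (oneS ⊖ mono (suc x))) ≋ (mono (suc x) ⊛ boundedGF x true x)
  boundedGF-top-step x = begin
    gT ⊛ (oneS ⊖ m)
      ≈⟨ ⊛-congʳ (oneS ⊖ m) (≋-trans (boundedGF-suc x true (suc x))
           (⊕-cong (boundedGF-beyond x (ℕ.n<1+n x)) (⊛-congˡ m (largestPartGF-true-top x)))) ⟩
    (zeroS ⊕ m ⊛ gF) ⊛ (oneS ⊖ m)  ≈⟨ ⊛-congʳ (oneS ⊖ m) (⊕-identityˡ (m ⊛ gF)) ⟩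
    (m ⊛ gF) ⊛ (oneS ⊖ m)          ≈⟨ ⊛-assoc m gF (oneS ⊖ m) ⟩
    m ⊛ (gF ⊛ (oneS ⊖ m))          ≈⟨ ⊛-congˡ m (boundedGF-false-step (ℕ.≤-refl {x})) ⟩
    m ⊛ boundedGF x true x         ∎
    where
    open ≋-Reasoning
    gT = boundedGF (suc x) true (suc x)
    gF = boundedGF (suc x) false x
    m = mono (suc x)

  boundedGF-empty : boundedGF 0 true 0 ≋ oneS
  boundedGF-empty zero    = refl
  boundedGF-empty (suc n) = refl

  boundedGF-product-top : ∀ j → (boundedGF j true j ⊛ qPoch j ⊛ negPoch j) ≋ (mono (suc j C 2) ⊛ negPoch j)
  boundedGF-product-top zero = begin
    (boundedGF 0 true 0 ⊛ oneS) ⊛ oneS  ≈⟨ ⊛-identityʳ _ ⟩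
    boundedGF 0 true 0 ⊛ oneS           ≈⟨ ⊛-identityʳ _ ⟩
    boundedGF 0 true 0                  ≈⟨ ≋-trans boundedGF-empty oneS≋mono0 ⟩
    mono 0                              ≈⟨ ⊛-identityʳ (mono 0) ⟨
    mono 0 ⊛ oneS                       ∎
    where open ≋-Reasoning
  boundedGF-product-top (suc i) = begin
    Gs ⊛ qPoch (suc i) ⊛ negPoch (suc i)
      ≈⟨ ⊛-cong (⊛-congˡ Gs (qPoch-suc i)) (negPoch-suc i) ⟩
    Gs ⊛ (qPoch i ⊛ (oneS ⊖ m)) ⊛ (negPoch i ⊛ (oneS ⊕ m))
      ≈⟨ solve 5 (λ g q f u m → g :* (q :* (u :- m)) :* (f :* (u :+ m)) := g :* (u :- m) :* q :* f :* (u :+ m))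
           (λ _ → refl) Gs (qPoch i) (negPoch i) oneS m ⟩
    Gs ⊛ (oneS ⊖ m) ⊛ qPoch i ⊛ negPoch i ⊛ (oneS ⊕ m)
      ≈⟨ ⊛-congʳ (oneS ⊕ m) (⊛-congʳ (negPoch i) (⊛-congʳ (qPoch i) (boundedGF-top-step i))) ⟩
    m ⊛ Gi ⊛ qPoch i ⊛ negPoch i ⊛ (oneS ⊕ m)
      ≈⟨ solve 5 (λ g q f u m → m :* g :* q :* f :* (u :+ m) := m :* (g :* q :* f) :* (u :+ m))
           (λ _ → refl) Gi (qPoch i) (negPoch i) oneS m ⟩
    m ⊛ (Gi ⊛ qPoch i ⊛ negPoch i) ⊛ (oneS ⊕ m)
      ≈⟨ ⊛-congʳ (oneS ⊕ m) (⊛-congˡ m (boundedGF-product-top i)) ⟩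
    m ⊛ (mono K ⊛ negPoch i) ⊛ (oneS ⊕ m)
      ≈⟨ solve 4 (λ m k f u → m :* (k :* f) :* (u :+ m) := (m :* k) :* (f :* (u :+ m)))
                 (λ _ → refl) m (mono K) (negPoch i) oneS ⟩
    (m ⊛ mono K) ⊛ (negPoch i ⊛ (oneS ⊕ m))
      ≈⟨ ⊛-cong (≋-trans (mono-⊛-mono (suc i) K)
                          (λ n → cong (λ e → mono e n) (trans (ℕ.+-comm (suc i) K) (sym ([2+m]C2 i)))))
                (≋-sym (negPoch-suc i)) ⟩
    mono (suc (suc i) C 2) ⊛ negPoch (suc i) ∎
    where
    open ≋-Reasoning
    Gs = boundedGF (suc i) true (suc i)
    Gi = boundedGF i true i
    m = mono (suc i)
    K = suc i C 2

  boundedGF-product-step : ∀ {b j} → j ≤ b →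
    (boundedGF b true j ⊛ qPoch b ⊛ negPoch j) ≋ (mono (suc j C 2) ⊛ negPoch b) →
    (boundedGF (suc b) true j ⊛ qPoch (suc b) ⊛ negPoch j) ≋ (mono (suc j C 2) ⊛ negPoch (suc b))
  boundedGF-product-step {b} {j} j≤b product = begin
    Gs ⊛ qPoch (suc b) ⊛ negPoch j
      ≈⟨ ⊛-congʳ (negPoch j) (⊛-congˡ Gs (qPoch-suc b)) ⟩
    Gs ⊛ (qPoch b ⊛ (oneS ⊖ m)) ⊛ negPoch j
      ≈⟨ solve 5 (λ g q f u m → g :* (q :* (u :- m)) :* f := g :* (u :- m) :* q :* f)
                 (λ _ → refl) Gs (qPoch b) (negPoch j) oneS m ⟩
    Gs ⊛ (oneS ⊖ m) ⊛ qPoch b ⊛ negPoch j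
      ≈⟨ ⊛-congʳ (negPoch j) (⊛-congʳ (qPoch b) (boundedGF-true-step j≤b)) ⟩
    Gb ⊛ (oneS ⊕ m) ⊛ qPoch b ⊛ negPoch j
      ≈⟨ solve 5 (λ g q f u m → g :* (u :+ m) :* q :* f := g :* q :* f :* (u :+ m))
                 (λ _ → refl) Gb (qPoch b) (negPoch j) oneS m ⟩
    Gb ⊛ qPoch b ⊛ negPoch j ⊛ (oneS ⊕ m)
      ≈⟨ ⊛-congʳ (oneS ⊕ m) product ⟩
    mono (suc j C 2) ⊛ negPoch b ⊛ (oneS ⊕ m)
      ≈⟨ ⊛-assoc (mono (suc j C 2)) (negPoch b) (oneS ⊕ m) ⟩
    mono (suc j C 2) ⊛ (negPoch b ⊛ (oneS ⊕ m))
      ≈⟨ ⊛-congˡ (mono (suc j C 2)) (≋-sym (negPoch-suc b)) ⟩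
    mono (suc j C 2) ⊛ negPoch (suc b) ∎
    where
    open ≋-Reasoning
    Gs = boundedGF (suc b) true j
    Gb = boundedGF b true j
    m = mono (suc b)

  boundedGF-product : ∀ {b j} → j ≤ b → (boundedGF b true j ⊛ qPoch b ⊛ negPoch j) ≋ (mono (suc j C 2) ⊛ negPoch b)
  boundedGF-product {zero}  z≤n = boundedGF-product-top 0
  boundedGF-product {suc b} j≤1+b with ℕ.m≤n⇒m<n∨m≡n j≤1+b
  ... | inj₁ j<1+b = boundedGF-product-step (ℕ.≤-pred j<1+b) (boundedGF-product (ℕ.≤-pred j<1+b))
  ... | inj₂ refl  = boundedGF-product-top (suc b)

  boundedGF-product-zero : ∀ b → (boundedGF b true 0 ⊛ qPoch b) ≋ negPoch b
  boundedGF-product-zero b = begin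
    boundedGF b true 0 ⊛ qPoch b             ≈⟨ ⊛-identityʳ _ ⟨
    boundedGF b true 0 ⊛ qPoch b ⊛ oneS      ≈⟨ boundedGF-product z≤n ⟩
    mono 0 ⊛ negPoch b                       ≈⟨ ⊛-congʳ (negPoch b) (≋-sym oneS≋mono0) ⟩
    oneS ⊛ negPoch b                         ≈⟨ ⊛-identityˡ (negPoch b) ⟩
    negPoch b                                ∎
    where open ≋-Reasoning

  boundedGF-quotient : ∀ b → boundedGF b true 0 ≋ (negPoch b ⊘ qPoch b)
  boundedGF-quotient b = ⊘-unique {g = qPoch b} (qPoch-head b) (boundedGF-product-zero b)

  boundedGF-sigmaTerm : ∀ {b j} → j ≤ b → boundedGF b true j ≋ (boundedGF b true 0 ⊛ sigmaTerm j)
  boundedGF-sigmaTerm {b} {j} j≤b =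
    ≋-trans (⊘-unique {mono K ⊛ G0} {negPoch j} {Gj} (negPoch-head j) cleared)
            (solve 3 (λ k g i → k :* g :* i := g :* (k :* i)) (λ _ → refl) (mono K) G0 (inv (negPoch j)))
    where
    open ≋-Reasoning
    K = suc j C 2
    G0 = boundedGF b true 0
    Gj = boundedGF b true j
    cleared : (Gj ⊛ negPoch j) ≋ (mono K ⊛ G0)
    cleared = ⊛-cancelʳ {g = qPoch b} (qPoch-head b) (begin
      Gj ⊛ negPoch j ⊛ qPoch b  ≈⟨ solve 3 (λ g f q → g :* f :* q := g :* q :* f) (λ _ → refl) Gj (negPoch j) (qPoch b) ⟩
      Gj ⊛ qPoch b ⊛ negPoch j  ≈⟨ boundedGF-product j≤b ⟩
      mono K ⊛ negPoch b        ≈⟨ ⊛-congˡ (mono K) (boundedGF-product-zero b) ⟨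
      mono K ⊛ (G0 ⊛ qPoch b)   ≈⟨ ⊛-assoc (mono K) G0 (qPoch b) ⟨
      mono K ⊛ G0 ⊛ qPoch b     ∎)

  boundedGF-stable : ∀ j {n N} → n ≤ N → boundedGF N true j n ≡ boundedGF n true j n
  boundedGF-stable j = stable⇒≡diagonal (λ x → boundedGF x true j) (λ x n n≤x →
    trans (boundedGF-suc x true j n)
          (trans (cong (λ t → boundedGF x true j n + t) (mono-⊛-below (suc x) (largestPartGF true j x) (s≤s n≤x)))
                 (ℤ.+-identityʳ _)))

  PbarGF≋[]boundedGF : ∀ N → PbarGF ≋[ N ] boundedGF N true 0
  PbarGF≋[]boundedGF N n n≤N = trans (cong +_ (pbar≡admissibleCount n)) (sym (boundedGF-stable 0 n≤N))

  PbarProd≋[]PbarGF : ∀ N → PbarProd ≋[ N ] PbarGF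
  PbarProd≋[]PbarGF N = ≋[]-trans truncate (≋[]-trans (≋⇒≋[] N (≋-sym (boundedGF-quotient (suc N))))
                                                 (≋[]-sym (λ n n≤N → PbarGF≋[]boundedGF (suc N) n (ℕ.m≤n⇒m≤1+n n≤N))))
    where
    truncate : PbarProd ≋[ N ] (negPoch (suc N) ⊘ qPoch (suc N))
    truncate = ⊛-cong-≋[] {pochInf minusQ} {negPoch (suc N)} {inv (pochInf q)} {inv (qPoch (suc N))}
      (pochInf-≋[] refl N) (inv-cong-≋[] (qPoch-head 1) (qPoch-head (suc N)) (pochInf-≋[] refl N))

  sigmaR≋[]sumSeries : ∀ N → sigmaR ≋[ N ] sumSeries (suc N) sigmaTerm
  sigmaR≋[]sumSeries N n n≤N =
    sym (sumTo-vanishing (λ j → sigmaTerm j n) (s≤s n≤N) (λ j 1+n<j → sigmaTerm-below (ℕ.<-trans (ℕ.n<1+n n) 1+n<j)))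

  sumBelow-as-sumTo : ∀ m (h : ℕ → ℕ) → + sumBelow (suc m) h ≡ sumTo m (λ j → + h j)
  sumBelow-as-sumTo zero    h = refl
  sumBelow-as-sumTo (suc m) h = cong (_+ + h (suc m)) (sumBelow-as-sumTo m h)

  sigmaMex≡sumTo-boundedGF : ∀ n → + sigmaMex n ≡ sumTo (suc n) (λ j → boundedGF n true j n)
  sigmaMex≡sumTo-boundedGF zero    = refl
  sigmaMex≡sumTo-boundedGF (suc n) = trans (cong +_ (sumOver-mexHat (suc n))) (sumBelow-as-sumTo (suc (suc n)) _)

  PbarGF⊛sigmaR≡sigmaMex : ∀ n → (PbarGF ⊛ sigmaR) n ≡ + sigmaMex n
  PbarGF⊛sigmaR≡sigmaMex n = begin
    (PbarGF ⊛ sigmaR) n                          ≡⟨ ⊛-cong-≋[] (PbarGF≋[]boundedGF n) (sigmaR≋[]sumSeries n) n ℕ.≤-refl ⟩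
    (G0 ⊛ sumSeries (suc n) sigmaTerm) n         ≡⟨ ⊛-sumSeries (suc n) G0 sigmaTerm n ⟩
    sumTo (suc n) (λ j → (G0 ⊛ sigmaTerm j) n)   ≡⟨ sumTo-cong≤ (suc n) term ⟩
    sumTo (suc n) (λ j → boundedGF n true j n)   ≡⟨ sigmaMex≡sumTo-boundedGF n ⟨
    + sigmaMex n                                 ∎
    where
    open ≡-Reasoning
    G0 = boundedGF n true 0
    term : ∀ j → j ≤ suc n → (G0 ⊛ sigmaTerm j) n ≡ boundedGF n true j n
    term j j≤1+n with ℕ.m≤n⇒m<n∨m≡n j≤1+n
    ... | inj₁ j<1+n = sym (boundedGF-sigmaTerm (ℕ.≤-pred j<1+n) n)
    ... | inj₂ refl  =
      trans (⊛-cong-≋[] {G0} {G0} {sigmaTerm (suc n)} {zeroS} (λ _ _ → refl) (λ k k≤n → sigmaTerm-below (s≤s k≤n))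
                        n ℕ.≤-refl)
            (trans (⊛-zeroʳ G0 n) (sym (boundedGF-beyond n (ℕ.n<1+n n) n)))

open BoundedOverpartitions

theorem1p2 : (SigmaMexGF ≋ (PbarProd ⊛ S1)) × ((PbarProd ⊛ S1) ≋ (PbarGF ⊛ sigmaR))
theorem1p2 = SigmaMexGF≋PbarProd⊛S1 , PbarProd⊛S1≋PbarGF⊛sigmaR
  where
  PbarProd⊛S1≋PbarGF⊛sigmaR : (PbarProd ⊛ S1) ≋ (PbarGF ⊛ sigmaR)
  PbarProd⊛S1≋PbarGF⊛sigmaR n = ⊛-cong-≋[] (PbarProd≋[]PbarGF n) (≋⇒≋[] n S1≋sigmaR) n ℕ.≤-refl

  SigmaMexGF≋PbarProd⊛S1 : SigmaMexGF ≋ (PbarProd ⊛ S1)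
  SigmaMexGF≋PbarProd⊛S1 n = sym (trans (PbarProd⊛S1≋PbarGF⊛sigmaR n) (PbarGF⊛sigmaR≡sigmaMex n))
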